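{- Let $n\ge1$ and $e,k\ge0$. There is a bijection between the set of bi-increasing permutations $\pi\in{\cal S}_n$ with ${\sf exc}(\pi)=e$ and ${\sf dexc}(\pi)=k$ and the set of parallelogram polyominoes of perimeter $2n+2$, width $e+1$ and area $n+k-e$.
   Context: Permutations $\pi\in{\cal S}_n$ are written as words $\pi_1\cdots\pi_n$. An excedance of $\pi$ is an integer $i\in[n-1]$ with $\pi_i>i$; ${\sf E}(\pi)$ is the set of excedances, ${\sf exc}(\pi)=|{\sf E}(\pi)|$, ${\sf dexc}(\pi)=\sum_{i\in{\sf E}(\pi)}(\pi_i-i)$, and ${\sf inv}(\pi)$ is the number of pairs $i<j$ with $\pi_i>\pi_j$. A permutation is bi-increasing if ${\sf inv}(\pi)={\sf dexc}(\pi)$. A parallelogram polyomino is a finite union of unit cells of the plane bounded by two lattice paths that start at the origin, use only unit steps north $[0,1]$ and east $[1,0]$, end at a common point, and meet only at their start and end points. Its width and height are the coordinates of the common end point, its perimeter is the total boundary length (twice the sum of width and height), and its area is its number of cells. -}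

module Defs where

open import Data.Nat using (ℕ; zero; suc; _+_; _*_; _∸_; _<_; _<ᵇ_; _≤_)
open import Data.Fin using (Fin; toℕ)
open import Data.Vec using (Vec; lookup)
open import Data.Nat.ListAction using (sum)
open import Data.List using (List; []; _∷_; map; allFin; length; filter)
open import Data.List.Membership.Propositional using (_∈_)
open import Data.Product using (_×_; _,_)
open import Data.Sum using (_⊎_)
import Data.Maybe
open import Data.Bool using (Bool; true; false; if_then_else_)
open import Relation.Binary.PropositionalEquality using (_≡_)
open import Function.Definitions using (Injective)

-- Permutations of [n], written as words π₁⋯πₙ.
-- Positions and values are 0-based (Fin n); the shift by one is
-- uniform, so π_i > i and π_i - i are unaffected.

IsPerm : ∀ {n} → Vec (Fin n) n → Set
IsPerm {n} w = Injective _≡_ _≡_ (lookup w)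

[_<?_] : ℕ → ℕ → ℕ
[ a <? b ] = if a <ᵇ b then 1 else 0

exc : ∀ {n} → Vec (Fin n) n → ℕ
exc {n} w = sum (map (λ i → [ toℕ i <? toℕ (lookup w i) ]) (allFin n))

-- dexc: sum over excedances i of (π_i - i)
-- (for a non-excedance, π_i ∸ i = 0, so summing π_i ∸ i over all i
--  equals the sum over excedances)
dexc : ∀ {n} → Vec (Fin n) n → ℕ
dexc {n} w = sum (map (λ i → [ toℕ i <? toℕ (lookup w i) ] * (toℕ (lookup w i) ∸ toℕ i)) (allFin n))

inv : ∀ {n} → Vec (Fin n) n → ℕ
inv {n} w = sum (map (λ i → sum (map (λ j →
              [ toℕ i <? toℕ j ] * [ toℕ (lookup w j) <? toℕ (lookup w i) ]) (allFin n))) (allFin n))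

BiIncreasing : ∀ {n} → Vec (Fin n) n → Set
BiIncreasing w = inv w ≡ dexc w

-- The set of bi-increasing permutations in S_n with exc = e, dexc = k.
-- Proof components are irrelevant, so elements are determined by the word.
record BiIncPerm (n e k : ℕ) : Set where
  constructor biinc
  field
    word     : Vec (Fin n) n
    .isPerm  : IsPerm word
    .biInc   : BiIncreasing word
    .excEq   : exc word ≡ e
    .dexcEq  : dexc word ≡ k

data Step : Set where
  N E : Step

Point : Set
Point = ℕ × ℕ

step : Step → Point → Point
step N (x , y) = (x , suc y)
step E (x , y) = (suc x , y)

pointsFrom : Point → List Step → List Point
pointsFrom p []       = p ∷ []
pointsFrom p (s ∷ ss) = p ∷ pointsFrom (step s p) ss

points : List Step → List Point
points = pointsFrom (0 , 0)

endFrom : Point → List Step → Point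
endFrom p []       = p
endFrom p (s ∷ ss) = endFrom (step s p) ss

endpoint : List Step → Point
endpoint = endFrom (0 , 0)

numE : List Step → ℕ
numE []       = 0
numE (E ∷ ss) = suc (numE ss)
numE (N ∷ ss) = numE ss

numN : List Step → ℕ
numN []       = 0
numN (N ∷ ss) = suc (numN ss)
numN (E ∷ ss) = numN ss

areaBelowFrom : ℕ → List Step → ℕ
areaBelowFrom y []       = 0
areaBelowFrom y (N ∷ ss) = areaBelowFrom (suc y) ss
areaBelowFrom y (E ∷ ss) = y + areaBelowFrom y ss

areaBelow : List Step → ℕ
areaBelow = areaBelowFrom 0

-- The upper path starts with a north step, the lower with an east step
-- (this fixes which boundary path is which, so each polyomino has
-- exactly one representation); they end at a common point and meet
-- only at their start and end points.
record ParallelogramPolyomino : Set where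
  constructor pp
  field
    upper    : List Step
    lower    : List Step
    .upperN  : Data.List.head upper ≡ Data.Maybe.just N
    .lowerE  : Data.List.head lower ≡ Data.Maybe.just E
    .sameEnd : endpoint upper ≡ endpoint lower
    .meetOnlyAtEnds : ∀ p → p ∈ points upper → p ∈ points lower →
                      p ≡ (0 , 0) ⊎ p ≡ endpoint upper
  width : ℕ
  width = numE upper
  height : ℕ
  height = numN upper
  perimeter : ℕ
  perimeter = 2 * (width + height)
  area : ℕ
  area = areaBelow upper ∸ areaBelow lower

open ParallelogramPolyomino public using (width; height; perimeter; area)

record PPSet (n e k : ℕ) : Set where
  constructor ppset
  field
    poly     : ParallelogramPolyomino
    .perEq   : perimeter poly ≡ 2 * n + 2
    .widthEq : width poly ≡ e + 1
    .areaEq  : area poly ≡ n + k ∸ e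

-- Write P for the set of excedances of π and Q = π(P) for the set of excedance values.
-- Always inv π = ∑ᵢ #{j > i : π j < π i} and #{j > i : π j < π i} ≥ π i − i at an excedance i,
-- so π is bi-increasing iff equality holds termwise: every excedance is a left-to-right maximum
-- and every other position a right-to-left minimum. Then π sends the r-th element of P to the
-- r-th element of Q and the r-th element of the complement of P to the r-th element of the
-- complement of Q, so π is determined by (P, Q); conversely this recipe gives a bi-increasing
-- permutation exactly when #(Q ∩ [0, t]) ≤ #(P ∩ [0, t)) for all t < n and #Q = #P.
-- These ballot pairs are the pairs of boundary paths of parallelogram polyominoes of perimeter
-- 2n + 2: the upper path has its i-th step east iff i ∈ Q (followed by a final east step), the
-- lower path starts east and then has its (i+1)-st step east iff i ∈ P. The width is #P + 1,
-- and the area is n + ∑_{i ∈ P} (π i − i − 1) = n + dexc π − exc π.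

module Submission where

open import Defs
open import Data.Bool using (Bool; true; false; if_then_else_; not; _∧_; T)
open import Data.Bool.Properties using (not-injective)
open import Data.Empty using (⊥-elim)
open import Data.Fin using (Fin; toℕ; fromℕ<)
import Data.Fin as Fin
open import Data.Fin.Properties using (toℕ-injective; toℕ<n; fromℕ<-toℕ; toℕ-fromℕ<)
import Data.List as List
open import Data.List using (List; []; _∷_; _++_; length; take; drop; head; map; allFin)
open import Data.List.Membership.Propositional using (_∈_)
open import Data.List.Properties using (take++drop≡id; length-drop; length-++; length-take; take-all)
import Data.List.Properties as Listₚ
open import Data.List.Relation.Unary.Any using (here; there)
open import Data.Maybe using (just)
open import Data.Nat
open import Data.Nat.ListAction using (sum)
open import Data.Nat.Properties
open import Data.Nat.Solver using (module +-*-Solver)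
open import Data.Product using (Σ-syntax; _×_; _,_; proj₁; proj₂)
open import Data.Sum using (_⊎_; inj₁; inj₂)
open import Data.Unit using (tt)
open import Data.Vec using (Vec; lookup; tabulate)
open import Data.Vec.Properties using (lookup∘tabulate; tabulate∘lookup; tabulate-cong)
import Data.Vec.Properties as Vecₚ
open import Function.Base using (_∘_)
open import Function.Bundles using (_⤖_; mk↔ₛ′)
open import Function.Properties.Inverse using (↔⇒⤖)
open import Relation.Binary.Definitions using (tri<; tri≈; tri>; DecidableEquality)
open import Relation.Binary.PropositionalEquality
open import Relation.Nullary using (¬_; yes; no)
open import Relation.Nullary.Decidable using (recompute)

T⇒≡true : ∀ {b} → T b → b ≡ true
T⇒≡true {true} _ = refl

≡true⇒T : ∀ {b} → b ≡ true → T b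
≡true⇒T refl = tt

¬T⇒≡false : ∀ {b} → ¬ T b → b ≡ false
¬T⇒≡false {true} h = ⊥-elim (h tt)
¬T⇒≡false {false} _ = refl

<⇒<ᵇ≡true : ∀ {m n} → m < n → (m <ᵇ n) ≡ true
<⇒<ᵇ≡true lt = T⇒≡true (<⇒<ᵇ lt)

≮⇒<ᵇ≡false : ∀ {m n} → ¬ m < n → (m <ᵇ n) ≡ false
≮⇒<ᵇ≡false {m} {n} h = ¬T⇒≡false (λ t → h (<ᵇ⇒< m n t))

<ᵇ≡true⇒< : ∀ {m n} → (m <ᵇ n) ≡ true → m < n
<ᵇ≡true⇒< {m} {n} e = <ᵇ⇒< m n (≡true⇒T e)

<ᵇ≡false⇒≮ : ∀ {m n} → (m <ᵇ n) ≡ false → ¬ m < n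
<ᵇ≡false⇒≮ e lt with () ← trans (sym e) (<⇒<ᵇ≡true lt)

≡⇒≡ᵇ≡true : ∀ {m n} → m ≡ n → (m ≡ᵇ n) ≡ true
≡⇒≡ᵇ≡true {m} {n} e = T⇒≡true (≡⇒≡ᵇ m n e)

≢⇒≡ᵇ≡false : ∀ {m n} → m ≢ n → (m ≡ᵇ n) ≡ false
≢⇒≡ᵇ≡false {m} {n} h = ¬T⇒≡false (λ t → h (≡ᵇ⇒≡ m n t))

≡ᵇ≡false⇒≢ : ∀ {m n} → (m ≡ᵇ n) ≡ false → m ≢ n
≡ᵇ≡false⇒≢ e m≡n with () ← trans (sym e) (≡⇒≡ᵇ≡true m≡n)

≡ᵇ≡true⇒≡ : ∀ {m n} → (m ≡ᵇ n) ≡ true → m ≡ n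
≡ᵇ≡true⇒≡ {m} {n} e = ≡ᵇ⇒≡ m n (≡true⇒T e)

≡ᵇ-sym : ∀ m n → (m ≡ᵇ n) ≡ (n ≡ᵇ m)
≡ᵇ-sym zero zero = refl
≡ᵇ-sym zero (suc n) = refl
≡ᵇ-sym (suc m) zero = refl
≡ᵇ-sym (suc m) (suc n) = ≡ᵇ-sym m n

true-or-false : ∀ b → b ≡ true ⊎ b ≡ false
true-or-false true = inj₁ refl
true-or-false false = inj₂ refl

𝟙 : Bool → ℕ
𝟙 b = if b then 1 else 0

𝟙≤1 : ∀ b → 𝟙 b ≤ 1
𝟙≤1 true = ≤-refl
𝟙≤1 false = z≤n

∑ : ℕ → (ℕ → ℕ) → ℕ
∑ zero f = 0
∑ (suc n) f = ∑ n f + f n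

∑-cong : ∀ n {f g : ℕ → ℕ} → (∀ i → i < n → f i ≡ g i) → ∑ n f ≡ ∑ n g
∑-cong zero h = refl
∑-cong (suc n) h = cong₂ _+_ (∑-cong n (λ i lt → h i (m<n⇒m<1+n lt))) (h n ≤-refl)

∑-distrib-+ : ∀ n (f g : ℕ → ℕ) → ∑ n (λ i → f i + g i) ≡ ∑ n f + ∑ n g
∑-distrib-+ zero f g = refl
∑-distrib-+ (suc n) f g rewrite ∑-distrib-+ n f g = +-*-Solver.solve 4
  (λ a b c d → (a :+ b) :+ (c :+ d) := (a :+ c) :+ (b :+ d)) refl (∑ n f) (∑ n g) (f n) (g n)
  where open +-*-Solver

∑-mono-≤ : ∀ n {f g : ℕ → ℕ} → (∀ i → i < n → f i ≤ g i) → ∑ n f ≤ ∑ n g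
∑-mono-≤ zero h = z≤n
∑-mono-≤ (suc n) h = +-mono-≤ (∑-mono-≤ n (λ i lt → h i (m<n⇒m<1+n lt))) (h n ≤-refl)

∑-mono-≤-≡⇒≡ : ∀ n {f g : ℕ → ℕ} → (∀ i → i < n → f i ≤ g i) → ∑ n f ≡ ∑ n g →
               ∀ i → i < n → f i ≡ g i
∑-mono-≤-≡⇒≡ (suc n) {f} {g} f≤g eq i i<1+n with m<1+n⇒m<n∨m≡n i<1+n
... | inj₁ i<n = ∑-mono-≤-≡⇒≡ n f≤g' ∑n≡ i i<n
  where
  f≤g' : ∀ j → j < n → f j ≤ g j
  f≤g' j lt = f≤g j (m<n⇒m<1+n lt)
  ∑n≡ : ∑ n f ≡ ∑ n g
  ∑n≡ = ≤-antisym (∑-mono-≤ n f≤g')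
          (+-cancelʳ-≤ (f n) _ _ (≤-trans (+-monoʳ-≤ (∑ n g) (f≤g n ≤-refl)) (≤-reflexive (sym eq))))
... | inj₂ refl = ≤-antisym (f≤g i ≤-refl)
      (+-cancelˡ-≤ (∑ i f) _ _ (≤-trans (+-monoˡ-≤ (g i) (∑-mono-≤ i (λ j lt → f≤g j (m<n⇒m<1+n lt))))
                                        (≤-reflexive (sym eq))))

∑-unroll-head : ∀ n (f : ℕ → ℕ) → ∑ (suc n) f ≡ f 0 + ∑ n (λ i → f (suc i))
∑-unroll-head zero f = +-comm 0 (f 0)
∑-unroll-head (suc n) f rewrite ∑-unroll-head n f = +-assoc (f 0) (∑ n (λ i → f (suc i))) (f (suc n))

∑-zero : ∀ n {f : ℕ → ℕ} → (∀ i → i < n → f i ≡ 0) → ∑ n f ≡ 0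
∑-zero zero h = refl
∑-zero (suc n) h rewrite ∑-zero n (λ i l → h i (m<n⇒m<1+n l)) | h n ≤-refl = refl

∑-comm : ∀ n m (f : ℕ → ℕ → ℕ) → ∑ n (λ i → ∑ m (f i)) ≡ ∑ m (λ j → ∑ n (λ i → f i j))
∑-comm zero m f = sym (∑-zero m (λ _ _ → refl))
∑-comm (suc n) m f rewrite ∑-comm n m f = sym (∑-distrib-+ m (λ j → ∑ n (λ i → f i j)) (f n))

∑-*ʳ : ∀ n (f : ℕ → ℕ) c → ∑ n (λ i → f i * c) ≡ ∑ n f * c
∑-*ʳ zero f c = refl
∑-*ʳ (suc n) f c rewrite ∑-*ʳ n f c = sym (*-distribʳ-+ c (∑ n f) (f n))

∑-1 : ∀ n → ∑ n (λ _ → 1) ≡ n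
∑-1 zero = refl
∑-1 (suc n) rewrite ∑-1 n = +-comm n 1

∑-δ : ∀ n v (h : ℕ → ℕ) → v < n → ∑ n (λ i → 𝟙 (i ≡ᵇ v) * h i) ≡ h v
∑-δ (suc n) v h v<1+n with m<1+n⇒m<n∨m≡n v<1+n
... | inj₁ v<n rewrite ∑-δ n v h v<n | ≢⇒≡ᵇ≡false {n} {v} (λ e → <-irrefl (sym e) v<n) = +-identityʳ (h v)
... | inj₂ refl rewrite ∑-zero n {λ i → 𝟙 (i ≡ᵇ v) * h i} (λ i l → cong (λ b → 𝟙 b * h i) (≢⇒≡ᵇ≡false (<⇒≢ l)))
                      | ≡⇒≡ᵇ≡true {v} refl = +-identityʳ (h v)

∑-split : ∀ t d (f : ℕ → ℕ) → ∑ (t + d) f ≡ ∑ t f + ∑ d (λ i → f (t + i))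
∑-split t zero f rewrite +-identityʳ t = sym (+-identityʳ (∑ t f))
∑-split t (suc d) f rewrite +-suc t d | ∑-split t d f = +-assoc (∑ t f) _ _

∑-restrict : ∀ t m (f : ℕ → ℕ) → t ≤ m → ∑ m (λ i → 𝟙 (i <ᵇ t) * f i) ≡ ∑ t f
∑-restrict t m f t≤m with m≤n⇒∃[o]m+o≡n t≤m
... | d , refl = begin
  ∑ (t + d) (λ i → 𝟙 (i <ᵇ t) * f i)                      ≡⟨ ∑-split t d _ ⟩
  ∑ t (λ i → 𝟙 (i <ᵇ t) * f i) + ∑ d (λ i → 𝟙 (t + i <ᵇ t) * f (t + i))
    ≡⟨ cong₂ _+_ (∑-cong t (λ i i<t → trans (cong (λ b → 𝟙 b * f i) (<⇒<ᵇ≡true i<t)) (+-identityʳ (f i))))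
                 (∑-zero d (λ i _ → cong (λ b → 𝟙 b * f (t + i)) (≮⇒<ᵇ≡false (m+n≮m t i)))) ⟩
  ∑ t f + 0                                                ≡⟨ +-identityʳ _ ⟩
  ∑ t f ∎
  where open ≡-Reasoning

∑-below : ∀ n t → t ≤ n → ∑ n (λ u → 𝟙 (u <ᵇ t)) ≡ t
∑-below n t t≤n = trans (∑-cong n (λ u _ → sym (*-identityʳ _))) (trans (∑-restrict t n (λ _ → 1) t≤n) (∑-1 t))

∑-positive : ∀ n (f : ℕ → ℕ) → 0 < ∑ n f → Σ[ i ∈ ℕ ] (i < n × 0 < f i)
∑-positive (suc n) f lt with f n in eq
... | suc x = n , ≤-refl , subst (0 <_) (sym eq) z<s
... | zero with i , i<n , pos ← ∑-positive n f (subst (0 <_) (+-identityʳ (∑ n f)) lt)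
  = i , m<n⇒m<1+n i<n , pos

∑-mono-range : ∀ {t t'} (f : ℕ → ℕ) → t ≤ t' → ∑ t f ≤ ∑ t' f
∑-mono-range {t} f t≤t' with m≤n⇒∃[o]m+o≡n t≤t'
... | d , refl rewrite ∑-split t d f = m≤m+n (∑ t f) _

count : (ℕ → Bool) → ℕ → ℕ
count q t = ∑ t (λ i → 𝟙 (q i))

count≤ : ∀ q t → count q t ≤ t
count≤ q t = ≤-trans (∑-mono-≤ t (λ i _ → 𝟙≤1 (q i))) (≤-reflexive (∑-1 t))

count-mono : ∀ q {t t'} → t ≤ t' → count q t ≤ count q t'
count-mono q = ∑-mono-range (λ i → 𝟙 (q i))

count-suc-true : ∀ q u → q u ≡ true → count q (suc u) ≡ suc (count q u)
count-suc-true q u qu rewrite qu = +-comm (count q u) 1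

count-strict : ∀ q {u v} → q u ≡ true → u < v → count q u < count q v
count-strict q {u} qu u<v = ≤-trans (≤-reflexive (sym (count-suc-true q u qu))) (count-mono q u<v)

count-<⇒< : ∀ q {u v} → count q u < count q v → u < v
count-<⇒< q {u} {v} lt = ≰⇒> (λ v≤u → <⇒≱ lt (count-mono q v≤u))

count-injective : ∀ q {u v} → q u ≡ true → q v ≡ true → count q u ≡ count q v → u ≡ v
count-injective q {u} {v} qu qv e with <-cmp u v
... | tri< u<v _ _ = ⊥-elim (<-irrefl e (count-strict q qu u<v))
... | tri≈ _ u≡v _ = u≡v
... | tri> _ _ v<u = ⊥-elim (<-irrefl (sym e) (count-strict q qv v<u))

count-not : ∀ q t → count q t + count (not ∘ q) t ≡ t
count-not q zero = refl
count-not q (suc t) with q t in qt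
... | true = begin
  count q t + 1 + (count (not ∘ q) t + 0) ≡⟨ cong₂ _+_ (+-comm (count q t) 1) (+-identityʳ _) ⟩
  suc (count q t + count (not ∘ q) t)     ≡⟨ cong suc (count-not q t) ⟩
  suc t ∎
  where open ≡-Reasoning
... | false = begin
  count q t + 0 + (count (not ∘ q) t + 1) ≡⟨ cong (_+ (count (not ∘ q) t + 1)) (+-identityʳ (count q t)) ⟩
  count q t + (count (not ∘ q) t + 1)     ≡⟨ sym (+-assoc (count q t) _ 1) ⟩
  count q t + count (not ∘ q) t + 1       ≡⟨ cong (_+ 1) (count-not q t) ⟩
  t + 1                                   ≡⟨ +-comm t 1 ⟩
  suc t ∎
  where open ≡-Reasoning

count-cong : ∀ t {p p' : ℕ → Bool} → (∀ i → i < t → p i ≡ p' i) → count p t ≡ count p' t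
count-cong t h = ∑-cong t (λ i l → cong 𝟙 (h i l))

-- select q r m is the position u < m with q u and count q u ≡ r, if there is one.
select : (ℕ → Bool) → ℕ → ℕ → ℕ
select q r zero = 0
select q r (suc m) = if q m ∧ (count q m ≡ᵇ r) then m else select q r m

select-bound : ∀ q r m → select q r (suc m) < suc m
select-bound q r zero with q 0 ∧ (count q 0 ≡ᵇ r)
... | true = s≤s z≤n
... | false = s≤s z≤n
select-bound q r (suc m) with q (suc m) ∧ (count q (suc m) ≡ᵇ r)
... | true = ≤-refl
... | false = m<n⇒m<1+n (select-bound q r m)

module _ (q : ℕ → Bool) (r : ℕ) where

  private
    below-new : ∀ m → (count q m ≡ᵇ r) ≡ false → r < count q m + 1 → r < count q m
    below-new m ne lt = ≤∧≢⇒< (s≤s⁻¹ (subst (r <_) (+-comm (count q m) 1) lt))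
                                 (λ r≡c → ≡ᵇ≡false⇒≢ ne (sym r≡c))

  select-correct : ∀ m → r < count q m → q (select q r m) ≡ true × count q (select q r m) ≡ r
  select-correct (suc m) lt with q m in qm | count q m ≡ᵇ r in cm
  ... | true | true = qm , ≡ᵇ≡true⇒≡ cm
  ... | true | false = select-correct m (below-new m cm lt)
  ... | false | _ = select-correct m (subst (r <_) (+-identityʳ (count q m)) lt)

  select< : ∀ m → r < count q m → select q r m < m
  select< (suc m) lt with q m in qm | count q m ≡ᵇ r in cm
  ... | true | true = ≤-refl
  ... | true | false = m<n⇒m<1+n (select< m (below-new m cm lt))
  ... | false | _ = m<n⇒m<1+n (select< m (subst (r <_) (+-identityʳ (count q m)) lt))

  select-unique : ∀ m v → v < m → q v ≡ true → count q v ≡ r → select q r m ≡ v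
  select-unique m v v<m qv cv
    with qs , cs ← select-correct m (subst (_< count q m) cv (count-strict q qv v<m))
    = count-injective q qs qv (trans cs (sym cv))

reconstruct : ℕ → (ℕ → Bool) → (ℕ → Bool) → ℕ → ℕ
reconstruct n p q i = if p i then select q (count p i) n else select (not ∘ q) (count (not ∘ p) i) n

<-reflect : ∀ (f : ℕ → ℕ) {i j} → (i < j → f i < f j) → f j < f i → j < i
<-reflect f {i} {j} f-mono fj<fi with <-cmp j i
... | tri< j<i _ _ = j<i
... | tri≈ _ refl _ = ⊥-elim (<-irrefl refl fj<fi)
... | tri> _ _ i<j = ⊥-elim (<-asym fj<fi (f-mono i<j))

-- Permutations of {0, …, n-1}, given as functions on ℕ

module Permutation (n : ℕ) (π : ℕ → ℕ) where

  isExc : ℕ → Bool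
  isExc i = i <ᵇ π i

  isExcValue : ℕ → Bool
  isExcValue v = 0 <ᵇ ∑ n (λ j → 𝟙 (π j ≡ᵇ v) * 𝟙 (j <ᵇ v))

  smallerBefore : ℕ → ℕ
  smallerBefore i = ∑ n (λ j → 𝟙 (j <ᵇ i) * 𝟙 (π j <ᵇ π i))

  smallerAfter : ℕ → ℕ
  smallerAfter i = ∑ n (λ j → 𝟙 (i <ᵇ j) * 𝟙 (π j <ᵇ π i))

  excGap : ℕ → ℕ
  excGap i = 𝟙 (isExc i) * (π i ∸ i)

  PrefixMax : ℕ → Set
  PrefixMax i = ∀ j → j < i → π j < π i

  SuffixMin : ℕ → Set
  SuffixMin i = ∀ j → i < j → j < n → π i < π j

  isExcValue-0 : isExcValue 0 ≡ false
  isExcValue-0 = cong (0 <ᵇ_) (∑-zero n (λ j _ → *-zeroʳ (𝟙 (π j ≡ᵇ 0))))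

  module Properties (π< : ∀ i → i < n → π i < n)
                    (π-injective : ∀ i j → i < n → j < n → π i ≡ π j → i ≡ j) where

    fibre≤1 : ∀ v m → m ≤ n → ∑ m (λ i → 𝟙 (π i ≡ᵇ v)) ≤ 1
    fibre≤1 v zero _ = z≤n
    fibre≤1 v (suc m) m<n with π m ≡ᵇ v in πm≡v
    ... | false = ≤-trans (≤-reflexive (+-identityʳ _)) (fibre≤1 v m (<⇒≤ m<n))
    ... | true = ≤-reflexive (cong (_+ 1) (∑-zero m (λ i i<m → cong 𝟙 (≢⇒≡ᵇ≡false (λ πi≡v →
        <⇒≢ i<m (π-injective i m (<-trans i<m m<n) m<n (trans πi≡v (sym (≡ᵇ≡true⇒≡ πm≡v)))))))))

    -- Each i < n lies in exactly one of the n fibres, and every fibre has at most one element.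
    fibre≡1 : ∀ v → v < n → ∑ n (λ i → 𝟙 (π i ≡ᵇ v)) ≡ 1
    fibre≡1 = ∑-mono-≤-≡⇒≡ n (λ v _ → fibre≤1 v n ≤-refl) (begin
      ∑ n (λ v → ∑ n (λ i → 𝟙 (π i ≡ᵇ v)))  ≡⟨ ∑-comm n n (λ v i → 𝟙 (π i ≡ᵇ v)) ⟩
      ∑ n (λ i → ∑ n (λ v → 𝟙 (π i ≡ᵇ v)))  ≡⟨ ∑-cong n one-fibre ⟩
      ∑ n (λ _ → 1) ∎)
      where
      open ≡-Reasoning
      one-fibre : ∀ i → i < n → ∑ n (λ v → 𝟙 (π i ≡ᵇ v)) ≡ 1
      one-fibre i i<n = trans (∑-cong n (λ v _ → trans (cong 𝟙 (≡ᵇ-sym (π i) v)) (sym (*-identityʳ _))))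
                              (∑-δ n (π i) (λ _ → 1) (π< i i<n))

    ∑-reindex : ∀ (g : ℕ → ℕ) → ∑ n (λ i → g (π i)) ≡ ∑ n g
    ∑-reindex g = begin
      ∑ n (λ i → g (π i))                           ≡⟨ ∑-cong n (λ i i<n → sym (∑-δ n (π i) g (π< i i<n))) ⟩
      ∑ n (λ i → ∑ n (λ v → 𝟙 (v ≡ᵇ π i) * g v))    ≡⟨ ∑-comm n n _ ⟩
      ∑ n (λ v → ∑ n (λ i → 𝟙 (v ≡ᵇ π i) * g v))    ≡⟨ ∑-cong n (λ v _ → ∑-*ʳ n (λ i → 𝟙 (v ≡ᵇ π i)) (g v)) ⟩
      ∑ n (λ v → ∑ n (λ i → 𝟙 (v ≡ᵇ π i)) * g v)    ≡⟨ ∑-cong n (λ v v<n → cong (_* g v) (fibre v v<n)) ⟩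
      ∑ n (λ v → 1 * g v)                           ≡⟨ ∑-cong n (λ v _ → *-identityˡ (g v)) ⟩
      ∑ n g ∎
      where
      open ≡-Reasoning
      fibre : ∀ v → v < n → ∑ n (λ i → 𝟙 (v ≡ᵇ π i)) ≡ 1
      fibre v v<n = trans (∑-cong n (λ i _ → cong 𝟙 (≡ᵇ-sym v (π i)))) (fibre≡1 v v<n)

    preimage : ∀ v → v < n → Σ[ i ∈ ℕ ] (i < n × π i ≡ v)
    preimage v v<n with ∑-positive n (λ i → 𝟙 (π i ≡ᵇ v)) (subst (0 <_) (sym (fibre≡1 v v<n)) z<s)
    ... | i , i<n , pos with π i ≡ᵇ v in πi≡v
    ... | true = i , i<n , ≡ᵇ≡true⇒≡ πi≡v

    isExcValue-π : ∀ i → i < n → isExcValue (π i) ≡ isExc i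
    isExcValue-π i i<n = trans (cong (0 <ᵇ_) fibre-below) (0<ᵇ𝟙 (isExc i))
      where
      π≡ᵇπ : ∀ j → j < n → (π j ≡ᵇ π i) ≡ (j ≡ᵇ i)
      π≡ᵇπ j j<n with j ≟ i
      ... | yes refl = trans (≡⇒≡ᵇ≡true {π j} refl) (sym (≡⇒≡ᵇ≡true {j} refl))
      ... | no j≢i = trans (≢⇒≡ᵇ≡false (λ e → j≢i (π-injective j i j<n i<n e))) (sym (≢⇒≡ᵇ≡false j≢i))
      fibre-below : ∑ n (λ j → 𝟙 (π j ≡ᵇ π i) * 𝟙 (j <ᵇ π i)) ≡ 𝟙 (isExc i)
      fibre-below = trans (∑-cong n (λ j j<n → cong (λ b → 𝟙 b * 𝟙 (j <ᵇ π i)) (π≡ᵇπ j j<n)))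
                          (∑-δ n i (λ j → 𝟙 (j <ᵇ π i)) i<n)
      0<ᵇ𝟙 : ∀ b → (0 <ᵇ 𝟙 b) ≡ b
      0<ᵇ𝟙 true = refl
      0<ᵇ𝟙 false = refl

    count-isExcValue : count isExcValue n ≡ count isExc n
    count-isExcValue = trans (sym (∑-reindex (λ v → 𝟙 (isExcValue v)))) (∑-cong n (λ i i<n → cong 𝟙 (isExcValue-π i i<n)))

    ∑-isExcValue : ∑ n (λ v → 𝟙 (isExcValue v) * v) ≡ ∑ n (λ i → 𝟙 (isExc i) * π i)
    ∑-isExcValue = trans (sym (∑-reindex (λ v → 𝟙 (isExcValue v) * v)))
                         (∑-cong n (λ i i<n → cong (λ b → 𝟙 b * π i) (isExcValue-π i i<n)))

    -- An excedance value v ≤ t is the image of an excedance i < v ≤ t.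
    isExcValue-ballot : ∀ t → t < n → count isExcValue (suc t) ≤ count isExc t
    isExcValue-ballot t t<n = begin
      count isExcValue (suc t)                           ≡⟨ ∑-restrict (suc t) n _ t<n ⟨
      ∑ n (λ v → 𝟙 (v <ᵇ suc t) * 𝟙 (isExcValue v))      ≡⟨ ∑-reindex (λ v → 𝟙 (v <ᵇ suc t) * 𝟙 (isExcValue v)) ⟨
      ∑ n (λ i → 𝟙 (π i <ᵇ suc t) * 𝟙 (isExcValue (π i))) ≤⟨ ∑-mono-≤ n term≤ ⟩
      ∑ n (λ i → 𝟙 (i <ᵇ t) * 𝟙 (isExc i))                ≡⟨ ∑-restrict t n _ (<⇒≤ t<n) ⟩
      count isExc t ∎
      where
      open ≤-Reasoning
      term≤ : ∀ i → i < n → 𝟙 (π i <ᵇ suc t) * 𝟙 (isExcValue (π i)) ≤ 𝟙 (i <ᵇ t) * 𝟙 (isExc i)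
      term≤ i i<n rewrite isExcValue-π i i<n with isExc i in i-exc
      ... | false = ≤-reflexive (trans (*-zeroʳ (𝟙 (π i <ᵇ suc t))) (sym (*-zeroʳ (𝟙 (i <ᵇ t)))))
      ... | true with π i <ᵇ suc t in πi≤t
      ... | false = z≤n
      ... | true rewrite <⇒<ᵇ≡true {i} {t} (<-≤-trans (<ᵇ≡true⇒< {i} {π i} i-exc) (s≤s⁻¹ (<ᵇ≡true⇒< {π i} πi≤t)))
                 = ≤-refl

    smallerBefore+smallerAfter : ∀ i → i < n → smallerBefore i + smallerAfter i ≡ π i
    smallerBefore+smallerAfter i i<n = begin
      smallerBefore i + smallerAfter i                 ≡⟨ ∑-distrib-+ n _ _ ⟨
      ∑ n (λ j → 𝟙 (j <ᵇ i) * 𝟙 (π j <ᵇ π i) + 𝟙 (i <ᵇ j) * 𝟙 (π j <ᵇ π i)) ≡⟨ ∑-cong n (λ j _ → split j) ⟩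
      ∑ n (λ j → 𝟙 (π j <ᵇ π i))                       ≡⟨ ∑-reindex (λ u → 𝟙 (u <ᵇ π i)) ⟩
      ∑ n (λ u → 𝟙 (u <ᵇ π i))                         ≡⟨ ∑-below n (π i) (<⇒≤ (π< i i<n)) ⟩
      π i ∎
      where
      open ≡-Reasoning
      split : ∀ j → 𝟙 (j <ᵇ i) * 𝟙 (π j <ᵇ π i) + 𝟙 (i <ᵇ j) * 𝟙 (π j <ᵇ π i) ≡ 𝟙 (π j <ᵇ π i)
      split j with <-cmp j i
      ... | tri< j<i _ _ rewrite <⇒<ᵇ≡true j<i | ≮⇒<ᵇ≡false {i} {j} (<⇒≯ j<i) = trans (+-identityʳ _) (+-identityʳ _)
      ... | tri> _ _ i<j rewrite <⇒<ᵇ≡true i<j | ≮⇒<ᵇ≡false {j} {i} (<⇒≯ i<j) = +-identityʳ _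
      ... | tri≈ _ refl _ rewrite ≮⇒<ᵇ≡false {j} {j} (<-irrefl refl) | ≮⇒<ᵇ≡false {π j} {π j} (<-irrefl refl) = refl

    smallerBefore≤ : ∀ i → i < n → smallerBefore i ≤ i
    smallerBefore≤ i i<n = begin
      smallerBefore i                  ≤⟨ ∑-mono-≤ n (λ j _ → *-monoʳ-≤ (𝟙 (j <ᵇ i)) (𝟙≤1 _)) ⟩
      ∑ n (λ j → 𝟙 (j <ᵇ i) * 1)       ≡⟨ ∑-cong n (λ j _ → *-identityʳ (𝟙 (j <ᵇ i))) ⟩
      ∑ n (λ j → 𝟙 (j <ᵇ i))           ≡⟨ ∑-below n i (<⇒≤ i<n) ⟩
      i ∎
      where open ≤-Reasoning

    smallerAfter≡π∸smallerBefore : ∀ i → i < n → smallerAfter i ≡ π i ∸ smallerBefore i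
    smallerAfter≡π∸smallerBefore i i<n = begin
      smallerAfter i                                        ≡⟨ m+n∸m≡n (smallerBefore i) (smallerAfter i) ⟨
      smallerBefore i + smallerAfter i ∸ smallerBefore i    ≡⟨ cong (_∸ smallerBefore i) (smallerBefore+smallerAfter i i<n) ⟩
      π i ∸ smallerBefore i ∎
      where open ≡-Reasoning

    excGap≤smallerAfter : ∀ i → i < n → excGap i ≤ smallerAfter i
    excGap≤smallerAfter i i<n with isExc i
    ... | false = z≤n
    ... | true = begin
      π i ∸ i + 0             ≡⟨ +-identityʳ _ ⟩
      π i ∸ i                 ≤⟨ ∸-monoʳ-≤ (π i) (smallerBefore≤ i i<n) ⟩
      π i ∸ smallerBefore i   ≡⟨ smallerAfter≡π∸smallerBefore i i<n ⟨
      smallerAfter i ∎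
      where open ≤-Reasoning

    -- inv = ∑ smallerAfter and dexc = ∑ excGap, with excGap ≤ smallerAfter termwise.
    bi-increasing⇒excGap≡smallerAfter : ∑ n smallerAfter ≡ ∑ n excGap → ∀ i → i < n → excGap i ≡ smallerAfter i
    bi-increasing⇒excGap≡smallerAfter e = ∑-mono-≤-≡⇒≡ n excGap≤smallerAfter (sym e)

    smallerBefore≡⇒prefixMax : ∀ i → i < n → smallerBefore i ≡ i → PrefixMax i
    smallerBefore≡⇒prefixMax i i<n L≡i j j<i = <ᵇ≡true⇒< (𝟙≡1 (trans (sym (*-identityˡ _)) (πj<πi j<i)))
      where
      all-smaller : ∀ j → j < n → 𝟙 (j <ᵇ i) * 𝟙 (π j <ᵇ π i) ≡ 𝟙 (j <ᵇ i) * 1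
      all-smaller = ∑-mono-≤-≡⇒≡ n (λ j _ → *-monoʳ-≤ (𝟙 (j <ᵇ i)) (𝟙≤1 _))
        (trans L≡i (sym (trans (∑-cong n (λ j _ → *-identityʳ (𝟙 (j <ᵇ i)))) (∑-below n i (<⇒≤ i<n)))))
      πj<πi : ∀ {j} → j < i → 1 * 𝟙 (π j <ᵇ π i) ≡ 1
      πj<πi {j} j<i with all-smaller j (<-trans j<i i<n)
      ... | e rewrite <⇒<ᵇ≡true j<i = e
      𝟙≡1 : ∀ {b} → 𝟙 b ≡ 1 → b ≡ true
      𝟙≡1 {true} _ = refl

    excGap≡smallerAfter⇒prefixMax : ∀ i → i < n → isExc i ≡ true → excGap i ≡ smallerAfter i → PrefixMax i
    excGap≡smallerAfter⇒prefixMax i i<n exc gap = smallerBefore≡⇒prefixMax i i<n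
      (sym (∸-cancelˡ-≡ (<⇒≤ (<ᵇ≡true⇒< exc)) (≤-trans (smallerBefore≤ i i<n) (<⇒≤ (<ᵇ≡true⇒< exc)))
        (begin
          π i ∸ i               ≡⟨ +-identityʳ _ ⟨
          𝟙 true * (π i ∸ i)    ≡⟨ cong (λ b → 𝟙 b * (π i ∸ i)) exc ⟨
          excGap i              ≡⟨ gap ⟩
          smallerAfter i        ≡⟨ smallerAfter≡π∸smallerBefore i i<n ⟩
          π i ∸ smallerBefore i ∎)))
      where open ≡-Reasoning

    smallerAfter≡0⇒suffixMin : ∀ i → i < n → smallerAfter i ≡ 0 → SuffixMin i
    smallerAfter≡0⇒suffixMin i i<n R≡0 j i<j j<n with <-cmp (π i) (π j)
    ... | tri< πi<πj _ _ = πi<πj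
    ... | tri≈ _ πi≡πj _ = ⊥-elim (<-irrefl (π-injective i j i<n j<n πi≡πj) i<j)
    ... | tri> _ _ πj<πi with () ← trans (∑-mono-≤-≡⇒≡ n (λ _ _ → z≤n) (trans (∑-zero n (λ _ _ → refl)) (sym R≡0)) j j<n)
                                    (cong₂ (λ a b → 𝟙 a * 𝟙 b) (<⇒<ᵇ≡true i<j) (<⇒<ᵇ≡true πj<πi))

    excGap≡smallerAfter⇒suffixMin : ∀ i → i < n → isExc i ≡ false → excGap i ≡ smallerAfter i → SuffixMin i
    excGap≡smallerAfter⇒suffixMin i i<n exc gap =
      smallerAfter≡0⇒suffixMin i i<n (trans (sym gap) (cong (λ b → 𝟙 b * (π i ∸ i)) exc))

    prefixMax⇒excGap≡smallerAfter : ∀ i → i < n → isExc i ≡ true → PrefixMax i → excGap i ≡ smallerAfter i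
    prefixMax⇒excGap≡smallerAfter i i<n exc prefixMax = begin
      excGap i               ≡⟨ cong (λ b → 𝟙 b * (π i ∸ i)) exc ⟩
      π i ∸ i + 0            ≡⟨ +-identityʳ _ ⟩
      π i ∸ i                ≡⟨ cong (π i ∸_) smallerBefore≡i ⟨
      π i ∸ smallerBefore i  ≡⟨ smallerAfter≡π∸smallerBefore i i<n ⟨
      smallerAfter i ∎
      where
      open ≡-Reasoning
      term : ∀ j → 𝟙 (j <ᵇ i) * 𝟙 (π j <ᵇ π i) ≡ 𝟙 (j <ᵇ i)
      term j with j <ᵇ i in j<i
      ... | false = refl
      ... | true rewrite <⇒<ᵇ≡true (prefixMax j (<ᵇ≡true⇒< j<i)) = refl
      smallerBefore≡i : smallerBefore i ≡ i
      smallerBefore≡i = trans (∑-cong n (λ j _ → term j)) (∑-below n i (<⇒≤ i<n))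

    suffixMin⇒excGap≡smallerAfter : ∀ i → i < n → isExc i ≡ false → SuffixMin i → excGap i ≡ smallerAfter i
    suffixMin⇒excGap≡smallerAfter i i<n exc suffixMin =
      trans (cong (λ b → 𝟙 b * (π i ∸ i)) exc) (sym (∑-zero n term))
      where
      term : ∀ j → j < n → 𝟙 (i <ᵇ j) * 𝟙 (π j <ᵇ π i) ≡ 0
      term j j<n with i <ᵇ j in i<j
      ... | false = refl
      ... | true rewrite ≮⇒<ᵇ≡false {π j} {π i} (<⇒≯ (suffixMin j (<ᵇ≡true⇒< i<j) j<n)) = refl

    -- π preserves the relative order of the p-positions, so it preserves ranks among them.
    count-image : (q p : ℕ → Bool) → (∀ j → j < n → q (π j) ≡ p j) → ∀ i → i < n →
                  (∀ j → j < n → p j ≡ true → (j < i → π j < π i) × (π j < π i → j < i)) →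
                  count q (π i) ≡ count p i
    count-image q p q∘π≡p i i<n order = begin
      count q (π i)                                ≡⟨ ∑-restrict (π i) n _ (<⇒≤ (π< i i<n)) ⟨
      ∑ n (λ v → 𝟙 (v <ᵇ π i) * 𝟙 (q v))           ≡⟨ ∑-reindex (λ v → 𝟙 (v <ᵇ π i) * 𝟙 (q v)) ⟨
      ∑ n (λ j → 𝟙 (π j <ᵇ π i) * 𝟙 (q (π j)))     ≡⟨ ∑-cong n term ⟩
      ∑ n (λ j → 𝟙 (j <ᵇ i) * 𝟙 (p j))             ≡⟨ ∑-restrict i n _ (<⇒≤ i<n) ⟩
      count p i ∎
      where
      open ≡-Reasoning
      term : ∀ j → j < n → 𝟙 (π j <ᵇ π i) * 𝟙 (q (π j)) ≡ 𝟙 (j <ᵇ i) * 𝟙 (p j)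
      term j j<n rewrite q∘π≡p j j<n with p j in pj
      ... | false = trans (*-zeroʳ (𝟙 (π j <ᵇ π i))) (sym (*-zeroʳ (𝟙 (j <ᵇ i))))
      ... | true with order j j<n pj
      ... | (preserve , reflect) with j <ᵇ i in j<i
      ... | true rewrite <⇒<ᵇ≡true (preserve (<ᵇ≡true⇒< j<i)) = refl
      ... | false rewrite ≮⇒<ᵇ≡false {π j} {π i} (λ lt → <ᵇ≡false⇒≮ j<i (reflect lt)) = refl

    module _ (bi-increasing : ∑ n smallerAfter ≡ ∑ n excGap) where

      prefixMax : ∀ i → i < n → isExc i ≡ true → PrefixMax i
      prefixMax i i<n exc = excGap≡smallerAfter⇒prefixMax i i<n exc (bi-increasing⇒excGap≡smallerAfter bi-increasing i i<n)

      suffixMin : ∀ i → i < n → isExc i ≡ false → SuffixMin i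
      suffixMin i i<n exc = excGap≡smallerAfter⇒suffixMin i i<n exc (bi-increasing⇒excGap≡smallerAfter bi-increasing i i<n)

      rank-exc : ∀ i → i < n → isExc i ≡ true → count isExcValue (π i) ≡ count isExc i
      rank-exc i i<n exc = count-image isExcValue isExc isExcValue-π i i<n
        (λ j j<n excj → prefixMax i i<n exc j , <-reflect π (prefixMax j j<n excj i))

      rank-nonExc : ∀ i → i < n → isExc i ≡ false →
                    count (not ∘ isExcValue) (π i) ≡ count (not ∘ isExc) i
      rank-nonExc i i<n exc = count-image (not ∘ isExcValue) (not ∘ isExc) (λ j j<n → cong not (isExcValue-π j j<n)) i i<n
        (λ j j<n excj → (λ j<i → suffixMin j j<n (not-injective excj) i j<i i<n) ,
                         <-reflect π (λ i<j → suffixMin i i<n exc j i<j j<n))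

      reconstruct-π : ∀ i → i < n → reconstruct n isExc isExcValue i ≡ π i
      reconstruct-π i i<n with true-or-false (isExc i)
      ... | inj₁ exc rewrite exc =
        select-unique isExcValue (count isExc i) n (π i) (π< i i<n) (trans (isExcValue-π i i<n) exc) (rank-exc i i<n exc)
      ... | inj₂ exc rewrite exc =
        select-unique (not ∘ isExcValue) (count (not ∘ isExc) i) n (π i) (π< i i<n)
          (cong not (trans (isExcValue-π i i<n) exc)) (rank-nonExc i i<n exc)

-- The permutation of a ballot pair

reconstruct-bound : ∀ m p q i → reconstruct (suc m) p q i < suc m
reconstruct-bound m p q i with p i
... | true = select-bound q _ m
... | false = select-bound (not ∘ q) _ m

module Reconstruction (n : ℕ) (p q : ℕ → Bool)
                      (ballot : ∀ t → t < n → count q (suc t) ≤ count p t)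
                      (balanced : count q n ≡ count p n) where

  σ : ℕ → ℕ
  σ = reconstruct n p q

  balanced-not : count (not ∘ p) n ≡ count (not ∘ q) n
  balanced-not = +-cancelˡ-≡ (count p n) _ _
    (trans (count-not p n) (trans (sym (count-not q n)) (cong (_+ count (not ∘ q) n) balanced)))

  rank-p< : ∀ i → i < n → p i ≡ true → count p i < count q n
  rank-p< i i<n pi = <-≤-trans (count-strict p pi ≤-refl) (≤-trans (count-mono p i<n) (≤-reflexive (sym balanced)))

  rank-notp< : ∀ i → i < n → p i ≡ false → count (not ∘ p) i < count (not ∘ q) n
  rank-notp< i i<n pi = <-≤-trans (count-strict (not ∘ p) (cong not pi) ≤-refl)
                                  (≤-trans (count-mono (not ∘ p) i<n) (≤-reflexive balanced-not))

  σ-p : ∀ i → i < n → p i ≡ true → q (σ i) ≡ true × count q (σ i) ≡ count p i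
  σ-p i i<n pi rewrite pi = select-correct q (count p i) n (rank-p< i i<n pi)

  σ-notp : ∀ i → i < n → p i ≡ false → not (q (σ i)) ≡ true × count (not ∘ q) (σ i) ≡ count (not ∘ p) i
  σ-notp i i<n pi rewrite pi = select-correct (not ∘ q) (count (not ∘ p) i) n (rank-notp< i i<n pi)

  σ< : ∀ i → i < n → σ i < n
  σ< i i<n with p i in pi
  ... | true = select< q (count p i) n (rank-p< i i<n pi)
  ... | false = select< (not ∘ q) (count (not ∘ p) i) n (rank-notp< i i<n pi)

  q∘σ : ∀ j → j < n → q (σ j) ≡ p j
  q∘σ j j<n with true-or-false (p j)
  ... | inj₁ pj = trans (proj₁ (σ-p j j<n pj)) (sym pj)
  ... | inj₂ pj = trans (not-injective (proj₁ (σ-notp j j<n pj))) (sym pj)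

  -- The ballot inequality at σ i forces σ i past i.
  σ-exc : ∀ i → i < n → p i ≡ true → i < σ i
  σ-exc i i<n pi = ≰⇒> λ σi≤i → <-irrefl refl (begin-strict
    count p i                  <⟨ n<1+n _ ⟩
    suc (count p i)            ≡⟨ cong suc (proj₂ (σ-p i i<n pi)) ⟨
    suc (count q (σ i))        ≡⟨ count-suc-true q (σ i) (proj₁ (σ-p i i<n pi)) ⟨
    count q (suc (σ i))        ≤⟨ count-mono q (s≤s σi≤i) ⟩
    count q (suc i)            ≤⟨ ballot i i<n ⟩
    count p i ∎)
    where open ≤-Reasoning

  σ-nonExc : ∀ i → i < n → p i ≡ false → σ i ≤ i
  σ-nonExc i i<n pi with σ i | σ-notp i i<n pi | σ< i i<n
  ... | zero | _ | _ = z≤n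
  ... | suc u | (_ , rank) | u<n = ≮⇒≥ λ i<1+u → <-irrefl (sym rank) (begin-strict
    count (not ∘ p) i        ≤⟨ count-mono (not ∘ p) (s≤s⁻¹ i<1+u) ⟩
    count (not ∘ p) u        <⟨ more-nonExc ⟩
    count (not ∘ q) (suc u) ∎)
    where
    open ≤-Reasoning
    -- By the ballot inequality at most count p u of the positions ≤ u are q-values.
    split : count q (suc u) + count (not ∘ q) (suc u) ≡ suc (count p u + count (not ∘ p) u)
    split = trans (count-not q (suc u)) (cong suc (sym (count-not p u)))
    more-nonExc : suc (count (not ∘ p) u) ≤ count (not ∘ q) (suc u)
    more-nonExc = +-cancelˡ-≤ (count q (suc u)) _ _ (≤-trans (≤-reflexive (+-suc _ _))
      (≤-trans (s≤s (+-monoˡ-≤ _ (ballot u (<-trans ≤-refl u<n)))) (≤-reflexive (sym split))))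

  σ-injective : ∀ i j → i < n → j < n → σ i ≡ σ j → i ≡ j
  σ-injective i j i<n j<n σi≡σj with true-or-false (p i) | true-or-false (p j)
  ... | inj₁ pi | inj₁ pj = count-injective p pi pj
        (trans (sym (proj₂ (σ-p i i<n pi))) (trans (cong (count q) σi≡σj) (proj₂ (σ-p j j<n pj))))
  ... | inj₁ pi | inj₂ pj
    with () ← trans (sym (proj₁ (σ-notp j j<n pj))) (cong not (trans (cong q (sym σi≡σj)) (proj₁ (σ-p i i<n pi))))
  ... | inj₂ pi | inj₁ pj
    with () ← trans (sym (proj₁ (σ-notp i i<n pi))) (cong not (trans (cong q σi≡σj) (proj₁ (σ-p j j<n pj))))
  ... | inj₂ pi | inj₂ pj = count-injective (not ∘ p) (cong not pi) (cong not pj)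
        (trans (sym (proj₂ (σ-notp i i<n pi))) (trans (cong (count (not ∘ q)) σi≡σj) (proj₂ (σ-notp j j<n pj))))

  σ-prefixMax : ∀ i → i < n → p i ≡ true → ∀ j → j < i → σ j < σ i
  σ-prefixMax i i<n pi j j<i with true-or-false (p j)
  ... | inj₁ pj = count-<⇒< q (begin-strict
    count q (σ j)       ≡⟨ proj₂ (σ-p j j<n pj) ⟩
    count p j           <⟨ count-strict p pj j<i ⟩
    count p i           ≡⟨ proj₂ (σ-p i i<n pi) ⟨
    count q (σ i) ∎)
    where
    open ≤-Reasoning
    j<n : j < n
    j<n = <-trans j<i i<n
  ... | inj₂ pj = ≤-<-trans (σ-nonExc j (<-trans j<i i<n) pj) (<-trans j<i (σ-exc i i<n pi))

  σ-suffixMin : ∀ i → i < n → p i ≡ false → ∀ j → i < j → j < n → σ i < σ j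
  σ-suffixMin i i<n pi j i<j j<n with true-or-false (p j)
  ... | inj₁ pj = ≤-<-trans (σ-nonExc i i<n pi) (<-trans i<j (σ-exc j j<n pj))
  ... | inj₂ pj = count-<⇒< (not ∘ q) (begin-strict
    count (not ∘ q) (σ i)   ≡⟨ proj₂ (σ-notp i i<n pi) ⟩
    count (not ∘ p) i       <⟨ count-strict (not ∘ p) (cong not pi) i<j ⟩
    count (not ∘ p) j       ≡⟨ proj₂ (σ-notp j j<n pj) ⟨
    count (not ∘ q) (σ j) ∎)
    where open ≤-Reasoning

  σ-isExc : ∀ i → i < n → (i <ᵇ σ i) ≡ p i
  σ-isExc i i<n with true-or-false (p i)
  ... | inj₁ pi = trans (<⇒<ᵇ≡true (σ-exc i i<n pi)) (sym pi)
  ... | inj₂ pi = trans (≮⇒<ᵇ≡false (λ lt → <⇒≱ lt (σ-nonExc i i<n pi))) (sym pi)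

stepOf : Bool → Step
stepOf true = E
stepOf false = N

isE : Step → Bool
isE E = true
isE N = false

stepOf-isE : ∀ x → stepOf (isE x) ≡ x
stepOf-isE N = refl
stepOf-isE E = refl

isE-stepOf : ∀ b → isE (stepOf b) ≡ b
isE-stepOf true = refl
isE-stepOf false = refl

path : (ℕ → Bool) → ℕ → ℕ → List Step
path q s zero = []
path q s (suc m) = stepOf (q s) ∷ path q (suc s) m

-- Out of range the value N is junk.
stepAt : List Step → ℕ → Step
stepAt [] _ = N
stepAt (x ∷ xs) zero = x
stepAt (x ∷ xs) (suc i) = stepAt xs i

numE+numN : ∀ xs → numE xs + numN xs ≡ length xs
numE+numN [] = refl
numE+numN (N ∷ xs) = trans (+-suc (numE xs) (numN xs)) (cong suc (numE+numN xs))
numE+numN (E ∷ xs) = cong suc (numE+numN xs)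

numE-++ : ∀ xs ys → numE (xs ++ ys) ≡ numE xs + numE ys
numE-++ [] ys = refl
numE-++ (N ∷ xs) ys = numE-++ xs ys
numE-++ (E ∷ xs) ys = cong suc (numE-++ xs ys)

length-path : ∀ q s m → length (path q s m) ≡ m
length-path q s zero = refl
length-path q s (suc m) = cong suc (length-path q (suc s) m)

numE-path-from : ∀ q s m → count q s + numE (path q s m) ≡ count q (s + m)
numE-path-from q s zero = trans (+-identityʳ _) (cong (count q) (sym (+-identityʳ s)))
numE-path-from q s (suc m) = begin
  count q s + numE (stepOf (q s) ∷ path q (suc s) m)    ≡⟨ cong (count q s +_) (numE-∷ (q s)) ⟩
  count q s + (𝟙 (q s) + numE (path q (suc s) m))      ≡⟨ +-assoc (count q s) _ _ ⟨
  count q (suc s) + numE (path q (suc s) m)            ≡⟨ numE-path-from q (suc s) m ⟩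
  count q (suc s + m)                                  ≡⟨ cong (count q) (+-suc s m) ⟨
  count q (s + suc m) ∎
  where
  open ≡-Reasoning
  numE-∷ : ∀ b {xs} → numE (stepOf b ∷ xs) ≡ 𝟙 b + numE xs
  numE-∷ true = refl
  numE-∷ false = refl

numE-path : ∀ q m → numE (path q 0 m) ≡ count q m
numE-path q m = numE-path-from q 0 m

take-path : ∀ q s m t → t ≤ m → take t (path q s m) ≡ path q s t
take-path q s m zero _ = refl
take-path q s (suc m) (suc t) (s≤s t≤m) = cong (stepOf (q s) ∷_) (take-path q (suc s) m t t≤m)

path-cong : ∀ q q' s m → (∀ i → s ≤ i → i < s + m → q i ≡ q' i) → path q s m ≡ path q' s m
path-cong q q' s zero h = refl
path-cong q q' s (suc m) h = cong₂ _∷_ (cong stepOf (h s ≤-refl (m<m+n s z<s)))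
  (path-cong q q' (suc s) m (λ i s<i i<s+m → h i (<⇒≤ s<i) (≤-trans i<s+m (≤-reflexive (sym (+-suc s m))))))

path-shift : ∀ (q : ℕ → Bool) s m → path (q ∘ suc) s m ≡ path q (suc s) m
path-shift q s zero = refl
path-shift q s (suc m) = cong (stepOf (q (suc s)) ∷_) (path-shift q (suc s) m)

path-stepAt : ∀ xs → path (isE ∘ stepAt xs) 0 (length xs) ≡ xs
path-stepAt [] = refl
path-stepAt (x ∷ xs) = cong₂ _∷_ (stepOf-isE x)
  (trans (sym (path-shift (isE ∘ stepAt (x ∷ xs)) 0 (length xs))) (path-stepAt xs))

stepAt-path : ∀ q s m i → i < m → stepAt (path q s m) i ≡ stepOf (q (s + i))
stepAt-path q s (suc m) zero _ = cong (stepOf ∘ q) (sym (+-identityʳ s))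
stepAt-path q s (suc m) (suc i) (s≤s i<m) = trans (stepAt-path q (suc s) m i i<m) (cong (stepOf ∘ q) (sym (+-suc s i)))

stepAt-++ : ∀ xs ys i → i < length xs → stepAt (xs ++ ys) i ≡ stepAt xs i
stepAt-++ (x ∷ xs) ys zero _ = refl
stepAt-++ (x ∷ xs) ys (suc i) (s≤s i<m) = stepAt-++ xs ys i i<m

stepAt-take : ∀ t xs i → i < t → stepAt (take t xs) i ≡ stepAt xs i
stepAt-take (suc t) [] i _ = refl
stepAt-take (suc t) (x ∷ xs) zero _ = refl
stepAt-take (suc t) (x ∷ xs) (suc i) (s≤s i<t) = stepAt-take t xs i i<t

endFrom≡ : ∀ x y xs → endFrom (x , y) xs ≡ (x + numE xs , y + numN xs)
endFrom≡ x y [] = cong₂ _,_ (sym (+-identityʳ x)) (sym (+-identityʳ y))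
endFrom≡ x y (N ∷ xs) = trans (endFrom≡ x (suc y) xs) (cong (x + numE xs ,_) (sym (+-suc y (numN xs))))
endFrom≡ x y (E ∷ xs) = trans (endFrom≡ (suc x) y xs) (cong (_, y + numN xs) (sym (+-suc x (numE xs))))

endpoint≡ : ∀ xs → endpoint xs ≡ (numE xs , numN xs)
endpoint≡ xs = endFrom≡ 0 0 xs

pointAfterFrom-∈ : ∀ s a b t → t ≤ length s →
                   (a + numE (take t s) , b + numN (take t s)) ∈ pointsFrom (a , b) s
pointAfterFrom-∈ [] a b zero _ = here (cong₂ _,_ (+-identityʳ a) (+-identityʳ b))
pointAfterFrom-∈ (x ∷ s) a b zero _ = here (cong₂ _,_ (+-identityʳ a) (+-identityʳ b))
pointAfterFrom-∈ (N ∷ s) a b (suc t) (s≤s t≤) = there (subst (_∈ pointsFrom (a , suc b) s)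
  (cong (a + numE (take t s) ,_) (sym (+-suc b _))) (pointAfterFrom-∈ s a (suc b) t t≤))
pointAfterFrom-∈ (E ∷ s) a b (suc t) (s≤s t≤) = there (subst (_∈ pointsFrom (suc a , b) s)
  (cong (_, b + numN (take t s)) (sym (+-suc a _))) (pointAfterFrom-∈ s (suc a) b t t≤))

∈-pointsFrom : ∀ s a b x → x ∈ pointsFrom (a , b) s →
               Σ[ t ∈ ℕ ] (t ≤ length s × x ≡ (a + numE (take t s) , b + numN (take t s)))
∈-pointsFrom [] a b x (here x≡) = 0 , z≤n , trans x≡ (cong₂ _,_ (sym (+-identityʳ a)) (sym (+-identityʳ b)))
∈-pointsFrom (_ ∷ s) a b x (here x≡) = 0 , z≤n , trans x≡ (cong₂ _,_ (sym (+-identityʳ a)) (sym (+-identityʳ b)))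
∈-pointsFrom (N ∷ s) a b x (there x∈) with t , t≤ , x≡ ← ∈-pointsFrom s a (suc b) x x∈ =
  suc t , s≤s t≤ , trans x≡ (cong (a + numE (take t s) ,_) (sym (+-suc b _)))
∈-pointsFrom (E ∷ s) a b x (there x∈) with t , t≤ , x≡ ← ∈-pointsFrom s (suc a) b x x∈ =
  suc t , s≤s t≤ , trans x≡ (cong (_, b + numN (take t s)) (sym (+-suc a _)))

eastSum : ℕ → ℕ → List Step → ℕ
eastSum y k [] = 0
eastSum y k (N ∷ s) = eastSum (suc y) k s
eastSum y k (E ∷ s) = (y + k) + eastSum y (suc k) s

triangle : ℕ → ℕ → ℕ
triangle k zero = 0
triangle k (suc m) = k + triangle (suc k) m

areaBelowFrom+triangle : ∀ s y k → areaBelowFrom y s + triangle k (numE s) ≡ eastSum y k s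
areaBelowFrom+triangle [] y k = refl
areaBelowFrom+triangle (N ∷ s) y k = areaBelowFrom+triangle s (suc y) k
areaBelowFrom+triangle (E ∷ s) y k = begin
  y + areaBelowFrom y s + (k + triangle (suc k) (numE s)) ≡⟨ +-*-Solver.solve 4 (λ a b c d → (a :+ b) :+ (c :+ d) := (a :+ c) :+ (b :+ d))
                                                              refl y (areaBelowFrom y s) k (triangle (suc k) (numE s)) ⟩
  y + k + (areaBelowFrom y s + triangle (suc k) (numE s)) ≡⟨ cong (y + k +_) (areaBelowFrom+triangle s y (suc k)) ⟩
  y + k + eastSum y (suc k) s ∎
  where open ≡-Reasoning
        open +-*-Solver

eastSum-++ : ∀ xs ys y k → eastSum y k (xs ++ ys) ≡ eastSum y k xs + eastSum (y + numN xs) (k + numE xs) ys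
eastSum-++ [] ys y k = cong₂ (λ a b → eastSum a b ys) (sym (+-identityʳ y)) (sym (+-identityʳ k))
eastSum-++ (N ∷ xs) ys y k = trans (eastSum-++ xs ys (suc y) k)
  (cong (λ a → eastSum (suc y) k xs + eastSum a (k + numE xs) ys) (sym (+-suc y (numN xs))))
eastSum-++ (E ∷ xs) ys y k = trans (cong (y + k +_) (eastSum-++ xs ys y (suc k)))
  (trans (sym (+-assoc (y + k) _ _))
    (cong (λ a → y + k + eastSum y (suc k) xs + eastSum (y + numN xs) a ys) (sym (+-suc k (numE xs)))))

-- Along a path from s, y + k is always s + c.
eastSum-path : ∀ q s m y k c → y + k ≡ s + c →
  ∑ s (λ j → 𝟙 (q j) * (j + c)) + eastSum y k (path q s m) ≡ ∑ (s + m) (λ j → 𝟙 (q j) * (j + c))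
eastSum-path q s zero y k c _ = trans (+-identityʳ _) (cong (λ a → ∑ a _) (sym (+-identityʳ s)))
eastSum-path q s (suc m) y k c y+k≡ with q s in qs
... | true = begin
  ∑ s f + (y + k + eastSum y (suc k) (path q (suc s) m))  ≡⟨ +-assoc (∑ s f) _ _ ⟨
  ∑ s f + (y + k) + eastSum y (suc k) (path q (suc s) m)  ≡⟨ cong (λ a → ∑ s f + a + eastSum y (suc k) (path q (suc s) m)) (trans y+k≡ (sym fs)) ⟩
  ∑ (suc s) f + eastSum y (suc k) (path q (suc s) m)      ≡⟨ eastSum-path q (suc s) m y (suc k) c (trans (+-suc y k) (cong suc y+k≡)) ⟩
  ∑ (suc s + m) f                                        ≡⟨ cong (λ a → ∑ a f) (+-suc s m) ⟨
  ∑ (s + suc m) f ∎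
  where
  open ≡-Reasoning
  f : ℕ → ℕ
  f j = 𝟙 (q j) * (j + c)
  fs : f s ≡ s + c
  fs rewrite qs = +-identityʳ (s + c)
... | false = begin
  ∑ s f + eastSum (suc y) k (path q (suc s) m)    ≡⟨ cong (_+ eastSum (suc y) k (path q (suc s) m)) (+-identityʳ (∑ s f)) ⟨
  ∑ s f + 0 + eastSum (suc y) k (path q (suc s) m) ≡⟨ cong (λ a → ∑ s f + a + eastSum (suc y) k (path q (suc s) m)) (sym fs) ⟩
  ∑ (suc s) f + eastSum (suc y) k (path q (suc s) m) ≡⟨ eastSum-path q (suc s) m (suc y) k c (cong suc y+k≡) ⟩
  ∑ (suc s + m) f                                  ≡⟨ cong (λ a → ∑ a f) (+-suc s m) ⟨
  ∑ (s + suc m) f ∎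
  where
  open ≡-Reasoning
  f : ℕ → ℕ
  f j = 𝟙 (q j) * (j + c)
  fs : f s ≡ 0
  fs rewrite qs = refl

-- The parallelogram polyomino of a ballot pair

upperOf : ℕ → (ℕ → Bool) → List Step
upperOf n q = path q 0 n ++ E ∷ []

lowerOf : ℕ → (ℕ → Bool) → List Step
lowerOf n p = E ∷ path p 0 n

take-++ : ∀ t (xs ys : List Step) → t ≤ length xs → take t (xs ++ ys) ≡ take t xs
take-++ zero xs ys _ = refl
take-++ (suc t) (x ∷ xs) ys (s≤s t≤) = cong (x ∷_) (take-++ t xs ys t≤)

length-upperOf : ∀ n q → length (upperOf n q) ≡ suc n
length-upperOf n q = trans (length-++ (path q 0 n)) (trans (cong (_+ 1) (length-path q 0 n)) (+-comm n 1))

numE-upperOf : ∀ n q → numE (upperOf n q) ≡ suc (count q n)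
numE-upperOf n q = trans (numE-++ (path q 0 n) (E ∷ [])) (trans (cong (_+ 1) (numE-path q n)) (+-comm (count q n) 1))

numE-lowerOf : ∀ n p → numE (lowerOf n p) ≡ suc (count p n)
numE-lowerOf n p = cong suc (numE-path p n)

numE-take-upperOf : ∀ n q u → u ≤ n → numE (take u (upperOf n q)) ≡ count q u
numE-take-upperOf n q u u≤n = begin
  numE (take u (path q 0 n ++ E ∷ []))  ≡⟨ cong numE (take-++ u (path q 0 n) _ (subst (u ≤_) (sym (length-path q 0 n)) u≤n)) ⟩
  numE (take u (path q 0 n))            ≡⟨ cong numE (take-path q 0 n u u≤n) ⟩
  numE (path q 0 u)                     ≡⟨ numE-path q u ⟩
  count q u ∎
  where open ≡-Reasoning

numE-take-lowerOf : ∀ n p u → u ≤ n → numE (take (suc u) (lowerOf n p)) ≡ suc (count p u)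
numE-take-lowerOf n p u u≤n = cong suc (trans (cong numE (take-path p 0 n u u≤n)) (numE-path p u))

numE+numN-take : ∀ s t → t ≤ length s → numE (take t s) + numN (take t s) ≡ t
numE+numN-take s t t≤ = trans (numE+numN (take t s)) (trans (length-take t s) (m≤n⇒m⊓n≡m t≤))

module FromBallot (n : ℕ) (p q : ℕ → Bool)
                  (ballot : ∀ t → t < n → count q (suc t) ≤ count p t)
                  (balanced : count q n ≡ count p n) where

  U : List Step
  U = upperOf n q

  L : List Step
  L = lowerOf n p

  length-U : length U ≡ suc n
  length-U = length-upperOf n q

  length-L : length L ≡ suc n
  length-L = cong suc (length-path p 0 n)

  numE-U≡numE-L : numE U ≡ numE L
  numE-U≡numE-L = trans (numE-upperOf n q) (trans (cong suc balanced) (sym (numE-lowerOf n p)))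

  numN-U≡numN-L : numN U ≡ numN L
  numN-U≡numN-L = +-cancelˡ-≡ (numE U) _ _ (begin
    numE U + numN U   ≡⟨ numE+numN U ⟩
    length U          ≡⟨ trans length-U (sym length-L) ⟩
    length L          ≡⟨ numE+numN L ⟨
    numE L + numN L   ≡⟨ cong (_+ numN L) numE-U≡numE-L ⟨
    numE U + numN L ∎)
    where open ≡-Reasoning

  sameEnd : endpoint U ≡ endpoint L
  sameEnd = trans (endpoint≡ U) (trans (cong₂ _,_ numE-U≡numE-L numN-U≡numN-L) (sym (endpoint≡ L)))

  -- Both paths have the same length, so a common point is reached after the same number t of steps;
  -- for 0 < t ≤ n the ballot inequality puts U strictly left of L.
  meetOnlyAtEnds : ∀ x → x ∈ points U → x ∈ points L → x ≡ (0 , 0) ⊎ x ≡ endpoint U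
  meetOnlyAtEnds x x∈U x∈L with ∈-pointsFrom U 0 0 x x∈U | ∈-pointsFrom L 0 0 x x∈L
  ... | t , t≤ , x≡ | t' , t'≤ , x≡' = meet t t≤ x≡ t≡t'
    where
    t≡t' : t ≡ t'
    t≡t' = trans (sym (numE+numN-take U t t≤))
           (trans (cong₂ _+_ (cong proj₁ (trans (sym x≡) x≡')) (cong proj₂ (trans (sym x≡) x≡')))
                  (numE+numN-take L t' t'≤))
    meet : ∀ t → t ≤ length U → x ≡ (numE (take t U) , numN (take t U)) → t ≡ t' →
           x ≡ (0 , 0) ⊎ x ≡ endpoint U
    meet zero _ x≡ _ = inj₁ x≡
    meet (suc u) 1+u≤ x≡ refl with m≤n⇒m<n∨m≡n (s≤s⁻¹ (≤-trans 1+u≤ (≤-reflexive length-U)))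
    ... | inj₂ refl = inj₂ (trans x≡ (trans (cong (λ s → (numE s , numN s))
                              (take-all (suc u) U (≤-reflexive length-U))) (sym (endpoint≡ U))))
    ... | inj₁ u<n = ⊥-elim (<-irrefl refl (≤-trans (≤-reflexive (sym crossing)) (ballot u u<n)))
      where
      crossing : count q (suc u) ≡ suc (count p u)
      crossing = trans (sym (numE-take-upperOf n q (suc u) u<n))
                 (trans (cong proj₁ (trans (sym x≡) x≡')) (numE-take-lowerOf n p u (<⇒≤ u<n)))

  perimeter-U : 2 * (numE U + numN U) ≡ 2 * n + 2
  perimeter-U = trans (cong (2 *_) (trans (numE+numN U) length-U)) (trans (*-distribˡ-+ 2 1 n) (+-comm 2 (2 * n)))

  width-U : numE U ≡ count q n + 1
  width-U = trans (numE-upperOf n q) (+-comm 1 (count q n))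

  areaBelow-U : areaBelow U + triangle 0 (numE U) ≡ ∑ n (λ j → 𝟙 (q j) * (j + 0)) + n
  areaBelow-U = begin
    areaBelow U + triangle 0 (numE U)                   ≡⟨ areaBelowFrom+triangle U 0 0 ⟩
    eastSum 0 0 U                                        ≡⟨ eastSum-++ (path q 0 n) (E ∷ []) 0 0 ⟩
    eastSum 0 0 (path q 0 n) + (numN P + numE P + 0)     ≡⟨ cong₂ _+_ (eastSum-path q 0 n 0 0 0 refl) last-step ⟩
    ∑ n (λ j → 𝟙 (q j) * (j + 0)) + n ∎
    where
    open ≡-Reasoning
    P : List Step
    P = path q 0 n
    last-step : numN P + numE P + 0 ≡ n
    last-step = trans (+-identityʳ _) (trans (+-comm (numN P) (numE P)) (trans (numE+numN P) (length-path q 0 n)))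

  areaBelow-L : areaBelow L + triangle 0 (numE L) ≡ ∑ n (λ j → 𝟙 (p j) * (j + 1))
  areaBelow-L = trans (areaBelowFrom+triangle L 0 0) (eastSum-path p 0 n 0 1 1 refl)

-- The ballot pair of a parallelogram polyomino

numE-take≤numE-take-suc : ∀ t s → numE (take t s) ≤ numE (take (suc t) s)
numE-take≤numE-take-suc zero s = z≤n
numE-take≤numE-take-suc (suc t) [] = ≤-refl
numE-take≤numE-take-suc (suc t) (N ∷ s) = numE-take≤numE-take-suc t s
numE-take≤numE-take-suc (suc t) (E ∷ s) = s≤s (numE-take≤numE-take-suc t s)

numE-take-suc≤ : ∀ t s → numE (take (suc t) s) ≤ suc (numE (take t s))
numE-take-suc≤ zero [] = z≤n
numE-take-suc≤ zero (N ∷ s) = z≤n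
numE-take-suc≤ zero (E ∷ s) = ≤-refl
numE-take-suc≤ (suc t) [] = z≤n
numE-take-suc≤ (suc t) (N ∷ s) = numE-take-suc≤ t s
numE-take-suc≤ (suc t) (E ∷ s) = s≤s (numE-take-suc≤ t s)

numE-take≤ : ∀ t s → numE (take t s) ≤ numE s
numE-take≤ zero s = z≤n
numE-take≤ (suc t) [] = z≤n
numE-take≤ (suc t) (N ∷ s) = numE-take≤ t s
numE-take≤ (suc t) (E ∷ s) = s≤s (numE-take≤ t s)

upperBits : List Step → ℕ → Bool
upperBits U v = isE (stepAt U v)

lowerBits : List Step → ℕ → Bool
lowerBits L i = isE (stepAt L (suc i))

module ToBallot (n : ℕ) (U L : List Step)
                (upperN : head U ≡ just N) (lowerE : head L ≡ just E)
                (sameEnd : endpoint U ≡ endpoint L)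
                (meetOnlyAtEnds : ∀ x → x ∈ points U → x ∈ points L → x ≡ (0 , 0) ⊎ x ≡ endpoint U)
                (numE+numN-U : numE U + numN U ≡ suc n) (1≤n : 1 ≤ n) where

  q : ℕ → Bool
  q = upperBits U

  p : ℕ → Bool
  p = lowerBits L

  numE-U≡numE-L : numE U ≡ numE L
  numE-U≡numE-L = cong proj₁ (trans (sym (endpoint≡ U)) (trans sameEnd (endpoint≡ L)))

  numN-U≡numN-L : numN U ≡ numN L
  numN-U≡numN-L = cong proj₂ (trans (sym (endpoint≡ U)) (trans sameEnd (endpoint≡ L)))

  length-U : length U ≡ suc n
  length-U = trans (sym (numE+numN U)) numE+numN-U

  length-L : length L ≡ suc n
  length-L = trans (sym (numE+numN L)) (trans (cong₂ _+_ (sym numE-U≡numE-L) (sym numN-U≡numN-L)) numE+numN-U)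

  ≤length-U : ∀ {t} → t ≤ n → t ≤ length U
  ≤length-U t≤n = ≤-trans t≤n (≤-trans (n≤1+n n) (≤-reflexive (sym length-U)))

  ≤length-L : ∀ {t} → t ≤ n → t ≤ length L
  ≤length-L t≤n = ≤-trans t≤n (≤-trans (n≤1+n n) (≤-reflexive (sym length-L)))

  -- After the same number t of steps with 0 < t ≤ n, both paths are at interior points;
  -- equal east counts would make them the same point.
  numE-take-≢ : ∀ t → 1 ≤ t → t ≤ n → numE (take t U) ≢ numE (take t L)
  numE-take-≢ t 1≤t t≤n eqE with meetOnlyAtEnds (numE (take t U) , numN (take t U))
           (pointAfterFrom-∈ U 0 0 t (≤length-U t≤n))
           (subst (_∈ points L) (cong₂ _,_ (sym eqE) (sym eqN)) (pointAfterFrom-∈ L 0 0 t (≤length-L t≤n)))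
    where
    eqN : numN (take t U) ≡ numN (take t L)
    eqN = +-cancelˡ-≡ (numE (take t U)) _ _ (trans (numE+numN-take U t (≤length-U t≤n))
            (trans (sym (numE+numN-take L t (≤length-L t≤n))) (cong (_+ numN (take t L)) (sym eqE))))
  ... | inj₁ origin = <-irrefl refl (≤-trans 1≤t (≤-reflexive
          (trans (sym (numE+numN-take U t (≤length-U t≤n))) (cong₂ _+_ (cong proj₁ origin) (cong proj₂ origin)))))
  ... | inj₂ end = <-irrefl refl (≤-trans (s≤s t≤n) (≤-reflexive (begin
          suc n                                  ≡⟨ numE+numN-U ⟨
          numE U + numN U                        ≡⟨ cong₂ _+_ (cong proj₁ end') (cong proj₂ end') ⟩
          numE (take t U) + numN (take t U)      ≡⟨ numE+numN-take U t (≤length-U t≤n) ⟩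
          t ∎)))
    where
    open ≡-Reasoning
    end' : (numE U , numN U) ≡ (numE (take t U) , numN (take t U))
    end' = sym (trans end (endpoint≡ U))

  U-left-of-L : ∀ t → 1 ≤ t → t ≤ n → numE (take t U) < numE (take t L)
  U-left-of-L (suc zero) _ _ = first-step U L upperN lowerE
    where
    first-step : ∀ U L → head U ≡ just N → head L ≡ just E → numE (take 1 U) < numE (take 1 L)
    first-step (N ∷ U) (E ∷ L) _ _ = s≤s z≤n
  U-left-of-L (suc (suc t)) _ t≤n = ≤∧≢⇒< (begin
    numE (take (suc (suc t)) U)   ≤⟨ numE-take-suc≤ (suc t) U ⟩
    suc (numE (take (suc t) U))   ≤⟨ U-left-of-L (suc t) (s≤s z≤n) (≤-trans (n≤1+n _) t≤n) ⟩
    numE (take (suc t) L)         ≤⟨ numE-take≤numE-take-suc (suc t) L ⟩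
    numE (take (suc (suc t)) L) ∎) (numE-take-≢ (suc (suc t)) (s≤s z≤n) t≤n)
    where open ≤-Reasoning

  L≡lowerOf : L ≡ lowerOf n p
  L≡lowerOf = from-head L lowerE length-L
    where
    from-head : ∀ L → head L ≡ just E → length L ≡ suc n → L ≡ E ∷ path (lowerBits L) 0 n
    from-head (E ∷ L') _ refl = cong (E ∷_) (sym (path-stepAt L'))

  take-U : take n U ≡ path q 0 n
  take-U = begin
    take n U                                                ≡⟨ path-stepAt (take n U) ⟨
    path (isE ∘ stepAt (take n U)) 0 (length (take n U))    ≡⟨ cong (path _ 0) length-take-U ⟩
    path (isE ∘ stepAt (take n U)) 0 n                      ≡⟨ path-cong _ _ 0 n (λ i _ i<n → cong isE (stepAt-take n U i i<n)) ⟩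
    path q 0 n ∎
    where
    open ≡-Reasoning
    length-take-U : length (take n U) ≡ n
    length-take-U = trans (length-take n U) (m≤n⇒m⊓n≡m (≤length-U ≤-refl))

  -- If the last step of U were north, U would end strictly left of L.
  drop-U : drop n U ≡ E ∷ []
  drop-U = single-E (drop n U) length-drop-U east
    where
    length-drop-U : length (drop n U) ≡ 1
    length-drop-U = trans (length-drop n U) (trans (cong (_∸ n) length-U) (m+n∸n≡m 1 n))
    numE-U≡ : numE U ≡ numE (take n U) + numE (drop n U)
    numE-U≡ = trans (cong numE (sym (take++drop≡id n U))) (numE-++ (take n U) (drop n U))
    east : 0 < numE (drop n U)
    east with numE (drop n U) in e
    ... | suc _ = s≤s z≤n
    ... | zero = ⊥-elim (<-irrefl refl (<-≤-trans (U-left-of-L n 1≤n ≤-refl) (≤-trans (numE-take≤ n L)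
                   (≤-reflexive (trans (sym numE-U≡numE-L) (trans numE-U≡ (trans (cong (numE (take n U) +_) e) (+-identityʳ _))))))))
    single-E : ∀ xs → length xs ≡ 1 → 0 < numE xs → xs ≡ E ∷ []
    single-E (E ∷ []) _ _ = refl

  U≡upperOf : U ≡ upperOf n q
  U≡upperOf = trans (sym (take++drop≡id n U)) (cong₂ _++_ take-U drop-U)

  ballot : ∀ t → t < n → count q (suc t) ≤ count p t
  ballot t t<n = s≤s⁻¹ (begin
    suc (count q (suc t))              ≡⟨ cong suc (numE-take-upperOf n q (suc t) t<n) ⟨
    suc (numE (take (suc t) (upperOf n q)))  ≡⟨ cong (λ s → suc (numE (take (suc t) s))) U≡upperOf ⟨
    suc (numE (take (suc t) U))        ≤⟨ U-left-of-L (suc t) (s≤s z≤n) t<n ⟩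
    numE (take (suc t) L)              ≡⟨ cong (λ s → numE (take (suc t) s)) L≡lowerOf ⟩
    numE (take (suc t) (lowerOf n p))  ≡⟨ numE-take-lowerOf n p t (<⇒≤ t<n) ⟩
    suc (count p t) ∎)
    where open ≤-Reasoning

  balanced : count q n ≡ count p n
  balanced = suc-injective (begin
    suc (count q n)     ≡⟨ numE-upperOf n q ⟨
    numE (upperOf n q)  ≡⟨ cong numE U≡upperOf ⟨
    numE U              ≡⟨ numE-U≡numE-L ⟩
    numE L              ≡⟨ cong numE L≡lowerOf ⟩
    numE (lowerOf n p)  ≡⟨ numE-lowerOf n p ⟩
    suc (count p n) ∎)
    where open ≡-Reasoning

-- Out of range the value 0 is junk.
lookupℕ : ∀ {n} → Vec (Fin n) n → ℕ → ℕ
lookupℕ {n} w i with i <? n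
... | yes i<n = toℕ (lookup w (fromℕ< i<n))
... | no _ = 0

lookupℕ-toℕ : ∀ {n} (w : Vec (Fin n) n) (j : Fin n) → lookupℕ w (toℕ j) ≡ toℕ (lookup w j)
lookupℕ-toℕ {n} w j with toℕ j <? n
... | yes j<n = cong (toℕ ∘ lookup w) (fromℕ<-toℕ j j<n)
... | no j≮n = ⊥-elim (j≮n (toℕ<n j))

lookupℕ-fromℕ< : ∀ {n} (w : Vec (Fin n) n) i (i<n : i < n) → lookupℕ w i ≡ toℕ (lookup w (fromℕ< i<n))
lookupℕ-fromℕ< w i i<n = trans (cong (lookupℕ w) (sym (toℕ-fromℕ< i<n))) (lookupℕ-toℕ w (fromℕ< i<n))

lookupℕ< : ∀ {n} (w : Vec (Fin n) n) i → i < n → lookupℕ w i < n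
lookupℕ< w i i<n = subst (_< _) (sym (lookupℕ-fromℕ< w i i<n)) (toℕ<n _)

lookupℕ-injective : ∀ {n} (w : Vec (Fin n) n) → IsPerm w → ∀ i j → i < n → j < n → lookupℕ w i ≡ lookupℕ w j → i ≡ j
lookupℕ-injective w isPerm i j i<n j<n eq = begin
  i                     ≡⟨ toℕ-fromℕ< i<n ⟨
  toℕ (fromℕ< i<n)       ≡⟨ cong toℕ (isPerm (toℕ-injective (trans (sym (lookupℕ-fromℕ< w i i<n)) (trans eq (lookupℕ-fromℕ< w j j<n))))) ⟩
  toℕ (fromℕ< j<n)       ≡⟨ toℕ-fromℕ< j<n ⟩
  j ∎
  where open ≡-Reasoning

sum-map-tabulate : ∀ {A : Set} {m} (f : Fin m → A) (g : A → ℕ) (h : ℕ → ℕ) →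
                   (∀ j → g (f j) ≡ h (toℕ j)) → sum (map g (List.tabulate f)) ≡ ∑ m h
sum-map-tabulate {m = zero} f g h _ = refl
sum-map-tabulate {m = suc m} f g h g∘f≡h = trans
  (cong₂ _+_ (g∘f≡h Fin.zero) (sum-map-tabulate (f ∘ Fin.suc) g (h ∘ suc) (g∘f≡h ∘ Fin.suc)))
  (sym (∑-unroll-head m h))

sum-map-allFin : ∀ {n} (g : Fin n → ℕ) (h : ℕ → ℕ) → (∀ j → g j ≡ h (toℕ j)) → sum (map g (allFin n)) ≡ ∑ n h
sum-map-allFin = sum-map-tabulate (λ j → j)

∸-balance : ∀ {a b c d} → a + c ≡ b + d → a ∸ b ≡ d ∸ c
∸-balance {a} {b} {c} {d} eq = begin
  a ∸ b                ≡⟨ [m+n]∸[m+o]≡n∸o c a b ⟨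
  (c + a) ∸ (c + b)    ≡⟨ cong₂ _∸_ (trans (+-comm c a) eq) (+-comm c b) ⟩
  (b + d) ∸ (b + c)    ≡⟨ [m+n]∸[m+o]≡n∸o b d c ⟩
  d ∸ c ∎
  where open ≡-Reasoning

module Word {m : ℕ} (w : Vec (Fin (suc m)) (suc m)) where

  n : ℕ
  n = suc m

  open Permutation n (lookupℕ w) public

  exc≡count : exc w ≡ count isExc n
  exc≡count = sum-map-allFin _ (𝟙 ∘ isExc) (λ j → cong (λ v → 𝟙 (toℕ j <ᵇ v)) (sym (lookupℕ-toℕ w j)))

  dexc≡∑excGap : dexc w ≡ ∑ n excGap
  dexc≡∑excGap = sum-map-allFin _ excGap (λ j → cong (λ v → 𝟙 (toℕ j <ᵇ v) * (v ∸ toℕ j)) (sym (lookupℕ-toℕ w j)))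

  inv≡∑smallerAfter : inv w ≡ ∑ n smallerAfter
  inv≡∑smallerAfter = sum-map-allFin _ smallerAfter (λ i → sum-map-allFin _ _ (λ j →
    cong₂ (λ a b → 𝟙 (toℕ i <ᵇ toℕ j) * 𝟙 (a <ᵇ b)) (sym (lookupℕ-toℕ w j)) (sym (lookupℕ-toℕ w i))))

  upper : List Step
  upper = upperOf n isExcValue

  lower : List Step
  lower = lowerOf n isExc

  head-upper : head upper ≡ just N
  head-upper rewrite isExcValue-0 = refl

  module _ (isPerm : IsPerm w) where

    open Properties (lookupℕ< w) (lookupℕ-injective w isPerm)
    open FromBallot n isExc isExcValue isExcValue-ballot count-isExcValue public
      using (sameEnd; meetOnlyAtEnds; perimeter-U)

    reconstruct-word : BiIncreasing w → ∀ i → i < n → reconstruct n isExc isExcValue i ≡ lookupℕ w i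
    reconstruct-word bi = reconstruct-π (trans (sym inv≡∑smallerAfter) (trans bi dexc≡∑excGap))

    width-upper : numE upper ≡ exc w + 1
    width-upper = trans (FromBallot.width-U n isExc isExcValue isExcValue-ballot count-isExcValue)
                        (cong (_+ 1) (trans count-isExcValue (sym exc≡count)))

    -- Up to a common correction term, the area under the upper path is n plus the sum of the
    -- excedance values π i, and the one under the lower path is the sum of i + 1 over the excedances i.
    area≡ : areaBelow upper ∸ areaBelow lower ≡ n + dexc w ∸ exc w
    area≡ = trans (∸-balance {aU} {aL} {e} {n + G} key) (cong₂ _∸_ (cong (n +_) (sym dexc≡∑excGap)) (sym exc≡count))
      where
      open FromBallot n isExc isExcValue isExcValue-ballot count-isExcValue using (areaBelow-U; areaBelow-L; numE-U≡numE-L)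
      X G e Tr aU aL : ℕ
      X = ∑ n (λ j → 𝟙 (isExc j) * j)
      G = ∑ n excGap
      e = count isExc n
      Tr = triangle 0 (numE upper)
      aU = areaBelow upper
      aL = areaBelow lower
      ∑-isExc-π : ∑ n (λ j → 𝟙 (isExc j) * lookupℕ w j) ≡ X + G
      ∑-isExc-π = trans (∑-cong n (λ j _ → term j)) (∑-distrib-+ n _ _)
        where
        term : ∀ j → 𝟙 (isExc j) * lookupℕ w j ≡ 𝟙 (isExc j) * j + excGap j
        term j with isExc j in exc-j
        ... | false = refl
        ... | true = trans (+-identityʳ _) (trans (sym (m+[n∸m]≡n (<⇒≤ (<ᵇ≡true⇒< {j} exc-j))))
                       (cong₂ _+_ (sym (+-identityʳ j)) (sym (+-identityʳ _))))
      aU+T : aU + Tr ≡ X + G + n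
      aU+T = trans areaBelow-U (cong (_+ n) (trans (∑-cong n (λ j _ → cong (𝟙 (isExcValue j) *_) (+-identityʳ j)))
                                                   (trans ∑-isExcValue ∑-isExc-π)))
      aL+T : aL + Tr ≡ X + e
      aL+T = trans (cong (λ k → aL + triangle 0 k) numE-U≡numE-L)
                   (trans areaBelow-L (trans (∑-cong n (λ j _ → trans (*-distribˡ-+ (𝟙 (isExc j)) j 1)
                                                            (cong (𝟙 (isExc j) * j +_) (*-identityʳ _))))
                                             (∑-distrib-+ n _ _)))
      key : aU + e ≡ aL + (n + G)
      key = +-cancelʳ-≡ (Tr + X) _ _ (begin
        aU + e + (Tr + X)         ≡⟨ solve 4 (λ a b c d → (a :+ b) :+ (c :+ d) := (a :+ c) :+ (d :+ b)) refl aU e Tr X ⟩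
        aU + Tr + (X + e)         ≡⟨ cong₂ _+_ aU+T (sym aL+T) ⟩
        X + G + n + (aL + Tr)     ≡⟨ solve 5 (λ a b c d x → (x :+ c :+ b) :+ (a :+ d) := (a :+ (b :+ c)) :+ (d :+ x)) refl aL n G Tr X ⟩
        aL + (n + G) + (Tr + X) ∎)
        where open ≡-Reasoning
              open +-*-Solver

select-cong : ∀ {q q' : ℕ → Bool} r m → (∀ i → i < m → q i ≡ q' i) → select q r m ≡ select q' r m
select-cong r zero _ = refl
select-cong {q} {q'} r (suc m) q≡q' rewrite q≡q' m ≤-refl
  | count-cong m {q} {q'} (λ i i<m → q≡q' i (m<n⇒m<1+n i<m))
  | select-cong {q} {q'} r m (λ i i<m → q≡q' i (m<n⇒m<1+n i<m)) = refl

reconstruct-cong : ∀ n {p p' q q'} → (∀ i → i < n → p i ≡ p' i) → (∀ v → v < n → q v ≡ q' v) →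
                   ∀ i → i < n → reconstruct n p q i ≡ reconstruct n p' q' i
reconstruct-cong n {p} {p'} {q} {q'} p≡p' q≡q' i i<n rewrite p≡p' i i<n with p' i
... | true = trans (cong (λ r → select q r n) (count-cong i p≡p'-below))
                   (select-cong (count p' i) n q≡q')
  where
  p≡p'-below : ∀ j → j < i → p j ≡ p' j
  p≡p'-below j j<i = p≡p' j (<-trans j<i i<n)
... | false = trans (cong (λ r → select (not ∘ q) r n) (count-cong i (λ j j<i → cong not (p≡p'-below j j<i))))
                    (select-cong (count (not ∘ p') i) n (λ v v<n → cong not (q≡q' v v<n)))
  where
  p≡p'-below : ∀ j → j < i → p j ≡ p' j
  p≡p'-below j j<i = p≡p' j (<-trans j<i i<n)

wordOf : ∀ m (p q : ℕ → Bool) → Vec (Fin (suc m)) (suc m)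
wordOf m p q = tabulate (λ j → fromℕ< (reconstruct-bound m p q (toℕ j)))

lookupℕ-wordOf : ∀ m p q i → i < suc m → lookupℕ (wordOf m p q) i ≡ reconstruct (suc m) p q i
lookupℕ-wordOf m p q i i<n = begin
  lookupℕ (wordOf m p q) i                                    ≡⟨ lookupℕ-fromℕ< (wordOf m p q) i i<n ⟩
  toℕ (lookup (wordOf m p q) (fromℕ< i<n))                     ≡⟨ cong toℕ (lookup∘tabulate (λ j → fromℕ< (reconstruct-bound m p q (toℕ j))) (fromℕ< i<n)) ⟩
  toℕ (fromℕ< (reconstruct-bound m p q (toℕ (fromℕ< i<n))))     ≡⟨ toℕ-fromℕ< _ ⟩
  reconstruct (suc m) p q (toℕ (fromℕ< i<n))                   ≡⟨ cong (reconstruct (suc m) p q) (toℕ-fromℕ< i<n) ⟩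
  reconstruct (suc m) p q i ∎
  where open ≡-Reasoning

module WordOfBallot (m : ℕ) (p q : ℕ → Bool)
                    (ballot : ∀ t → t < suc m → count q (suc t) ≤ count p t)
                    (balanced : count q (suc m) ≡ count p (suc m)) where

  word : Vec (Fin (suc m)) (suc m)
  word = wordOf m p q

  open Word word
  open Reconstruction n p q ballot balanced

  lookupℕ-injective-word : ∀ i j → i < n → j < n → lookupℕ word i ≡ lookupℕ word j → i ≡ j
  lookupℕ-injective-word i j i<n j<n eq =
    σ-injective i j i<n j<n (trans (sym (lookupℕ-wordOf m p q i i<n)) (trans eq (lookupℕ-wordOf m p q j j<n)))

  isPerm : IsPerm word
  isPerm {x} {y} eq = toℕ-injective (lookupℕ-injective-word (toℕ x) (toℕ y) (toℕ<n x) (toℕ<n y)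
    (trans (lookupℕ-toℕ word x) (trans (cong toℕ eq) (sym (lookupℕ-toℕ word y)))))

  open Properties (lookupℕ< word) lookupℕ-injective-word

  isExc≡p : ∀ i → i < n → isExc i ≡ p i
  isExc≡p i i<n = trans (cong (i <ᵇ_) (lookupℕ-wordOf m p q i i<n)) (σ-isExc i i<n)

  isExcValue≡q : ∀ v → v < n → isExcValue v ≡ q v
  isExcValue≡q v v<n with j , j<n , refl ← preimage v v<n = begin
    isExcValue (lookupℕ word j)   ≡⟨ isExcValue-π j j<n ⟩
    isExc j                       ≡⟨ isExc≡p j j<n ⟩
    p j                           ≡⟨ q∘σ j j<n ⟨
    q (σ j)                       ≡⟨ cong q (lookupℕ-wordOf m p q j j<n) ⟨
    q (lookupℕ word j) ∎
    where open ≡-Reasoning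

  bi-increasing : BiIncreasing word
  bi-increasing = trans inv≡∑smallerAfter (trans (∑-cong n (λ i i<n → sym (excGap≡smallerAfter i i<n))) (sym dexc≡∑excGap))
    where
    σ<σ : ∀ {i j} → i < n → j < n → σ i < σ j → lookupℕ word i < lookupℕ word j
    σ<σ {i} {j} i<n j<n = subst₂ _<_ (sym (lookupℕ-wordOf m p q i i<n)) (sym (lookupℕ-wordOf m p q j j<n))
    excGap≡smallerAfter : ∀ i → i < n → excGap i ≡ smallerAfter i
    excGap≡smallerAfter i i<n with true-or-false (p i)
    ... | inj₁ pi = prefixMax⇒excGap≡smallerAfter i i<n (trans (isExc≡p i i<n) pi)
                      (λ j j<i → σ<σ (<-trans j<i i<n) i<n (σ-prefixMax i i<n pi j j<i))
    ... | inj₂ pi = suffixMin⇒excGap≡smallerAfter i i<n (trans (isExc≡p i i<n) pi)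
                      (λ j i<j j<n → σ<σ i<n j<n (σ-suffixMin i i<n pi j i<j j<n))

  exc≡ : exc word ≡ count p n
  exc≡ = trans exc≡count (count-cong n isExc≡p)

  upper≡ : upper ≡ upperOf n q
  upper≡ = cong (_++ E ∷ []) (path-cong isExcValue q 0 n (λ v _ v<n → isExcValue≡q v v<n))

  lower≡ : lower ≡ lowerOf n p
  lower≡ = cong (E ∷_) (path-cong isExc p 0 n (λ i _ i<n → isExc≡p i i<n))

-- The bijection

_≟-Step_ : DecidableEquality Step
N ≟-Step N = yes refl
N ≟-Step E = no (λ ())
E ≟-Step N = no (λ ())
E ≟-Step E = yes refl

polyominoOf : ∀ {m} (w : Vec (Fin (suc m)) (suc m)) → .(IsPerm w) → ParallelogramPolyomino
polyominoOf w isPerm = pp upper lower head-upper refl (sameEnd isPerm) (meetOnlyAtEnds isPerm)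
  where open Word w

2*a≡2*n+2⇒a≡1+n : ∀ {a n} → 2 * a ≡ 2 * n + 2 → a ≡ suc n
2*a≡2*n+2⇒a≡1+n {a} {n} eq = *-cancelˡ-≡ a (suc n) 2 (trans eq (trans (+-comm (2 * n) 2) (sym (*-distribˡ-+ 2 1 n))))

+-∸-cancelˡ : ∀ {n a b e} → e ≤ n → n + a ∸ e ≡ n + b ∸ e → a ≡ b
+-∸-cancelˡ {n} {a} {b} e≤n eq = +-cancelˡ-≡ n a b (∸-cancelʳ-≡ (≤-trans e≤n (m≤m+n n a)) (≤-trans e≤n (m≤m+n n b)) eq)

BiIncPerm-≡ : ∀ {n e k} {x y : BiIncPerm n e k} → BiIncPerm.word x ≡ BiIncPerm.word y → x ≡ y
BiIncPerm-≡ {x = biinc w _ _ _ _} refl = refl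

PPSet-≡ : ∀ {n e k} {x y : PPSet n e k} →
          ParallelogramPolyomino.upper (PPSet.poly x) ≡ ParallelogramPolyomino.upper (PPSet.poly y) →
          ParallelogramPolyomino.lower (PPSet.poly x) ≡ ParallelogramPolyomino.lower (PPSet.poly y) → x ≡ y
PPSet-≡ {x = ppset (pp U L _ _ _ _) _ _ _} refl refl = refl

module Bijection (m e k : ℕ) where

  n : ℕ
  n = suc m

  module _ (w : Vec (Fin n) n) (isPerm : IsPerm w) where

    open Word w hiding (n; area≡)

    perimeter≡ : perimeter (polyominoOf w isPerm) ≡ 2 * n + 2
    perimeter≡ = perimeter-U isPerm

    width≡ : exc w ≡ e → width (polyominoOf w isPerm) ≡ e + 1
    width≡ exc≡e = trans (width-upper isPerm) (cong (_+ 1) exc≡e)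

    area≡ : exc w ≡ e → dexc w ≡ k → area (polyominoOf w isPerm) ≡ n + k ∸ e
    area≡ exc≡e dexc≡k = trans (Word.area≡ w isPerm) (cong₂ (λ a b → n + a ∸ b) dexc≡k exc≡e)

    wordOf-polyominoOf : BiIncreasing w → wordOf m (lowerBits lower) (upperBits upper) ≡ w
    wordOf-polyominoOf bi = trans (sym (tabulate∘lookup w')) (trans (tabulate-cong pointwise) (tabulate∘lookup w))
      where
      w' : Vec (Fin n) n
      w' = wordOf m (lowerBits lower) (upperBits upper)
      lowerBits≡ : ∀ i → i < n → lowerBits lower i ≡ isExc i
      lowerBits≡ i i<n = trans (cong isE (stepAt-path isExc 0 n i i<n)) (isE-stepOf (isExc i))
      upperBits≡ : ∀ v → v < n → upperBits upper v ≡ isExcValue v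
      upperBits≡ v v<n = trans (cong isE (trans (stepAt-++ (path isExcValue 0 n) (E ∷ []) v (subst (v <_) (sym (length-path isExcValue 0 n)) v<n))
                                             (stepAt-path isExcValue 0 n v v<n)))
                               (isE-stepOf (isExcValue v))
      pointwise : ∀ j → lookup (w') j ≡ lookup w j
      pointwise j = toℕ-injective (begin
        toℕ (lookup (w') j)  ≡⟨ lookupℕ-toℕ w' j ⟨
        lookupℕ (w') (toℕ j) ≡⟨ lookupℕ-wordOf m (lowerBits lower) (upperBits upper) (toℕ j) (toℕ<n j) ⟩
        reconstruct n (lowerBits lower) (upperBits upper) (toℕ j)      ≡⟨ reconstruct-cong n lowerBits≡ upperBits≡ (toℕ j) (toℕ<n j) ⟩
        reconstruct n isExc isExcValue (toℕ j)                         ≡⟨ reconstruct-word isPerm bi (toℕ j) (toℕ<n j) ⟩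
        lookupℕ w (toℕ j)                                              ≡⟨ lookupℕ-toℕ w j ⟩
        toℕ (lookup w j) ∎)
        where open ≡-Reasoning

  module _ (U L : List Step) (upperN : head U ≡ just N) (lowerE : head L ≡ just E)
           (sameEnd : endpoint U ≡ endpoint L)
           (meetOnlyAtEnds : ∀ x → x ∈ points U → x ∈ points L → x ≡ (0 , 0) ⊎ x ≡ endpoint U)
           (perimeter≡ : 2 * (numE U + numN U) ≡ 2 * n + 2) where

    open ToBallot n U L upperN lowerE sameEnd meetOnlyAtEnds (2*a≡2*n+2⇒a≡1+n perimeter≡) (s≤s z≤n)
    open WordOfBallot m p q ballot balanced public using (isPerm; bi-increasing)
    open WordOfBallot m p q ballot balanced using (word; exc≡; upper≡; lower≡)

    upper-word : Word.upper word ≡ U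
    upper-word = trans upper≡ (sym U≡upperOf)

    lower-word : Word.lower word ≡ L
    lower-word = trans lower≡ (sym L≡lowerOf)

    exc-word : numE U ≡ e + 1 → exc word ≡ e
    exc-word width≡ = trans exc≡ (trans (sym balanced) (suc-injective (begin
      suc (count q n)      ≡⟨ numE-upperOf n q ⟨
      numE (upperOf n q)   ≡⟨ cong numE U≡upperOf ⟨
      numE U               ≡⟨ width≡ ⟩
      e + 1                ≡⟨ +-comm e 1 ⟩
      suc e ∎)))
      where open ≡-Reasoning

    dexc-word : numE U ≡ e + 1 → areaBelow U ∸ areaBelow L ≡ n + k ∸ e → dexc word ≡ k
    dexc-word width≡ area≡ = +-∸-cancelˡ {n} e≤n (begin
      n + dexc word ∸ e                                        ≡⟨ cong (λ x → n + dexc word ∸ x) (exc-word width≡) ⟨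
      n + dexc word ∸ exc word                                 ≡⟨ Word.area≡ word isPerm ⟨
      areaBelow (Word.upper word) ∸ areaBelow (Word.lower word) ≡⟨ cong₂ (λ a b → areaBelow a ∸ areaBelow b) upper-word lower-word ⟩
      areaBelow U ∸ areaBelow L                                ≡⟨ area≡ ⟩
      n + k ∸ e ∎)
      where
      open ≡-Reasoning
      e≤n : e ≤ n
      e≤n = subst (_≤ n) (trans (sym exc≡) (exc-word width≡)) (count≤ p n)

  to : BiIncPerm n e k → PPSet n e k
  to (biinc w isPerm _ exc≡e dexc≡k) =
    ppset (polyominoOf w isPerm) (perimeter≡ w isPerm) (width≡ w isPerm exc≡e) (area≡ w isPerm exc≡e dexc≡k)

  from : PPSet n e k → BiIncPerm n e k
  from (ppset (pp U L upperN lowerE sameEnd meet) perimeter≡ width≡ area≡) =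
    biinc (wordOf m (lowerBits L) (upperBits U))
          (isPerm U L upperN lowerE sameEnd meet perimeter≡)
          (bi-increasing U L upperN lowerE sameEnd meet perimeter≡)
          (exc-word U L upperN lowerE sameEnd meet perimeter≡ width≡)
          (dexc-word U L upperN lowerE sameEnd meet perimeter≡ width≡ area≡)

  -- The proofs inside the records are irrelevant, so the equations are recomputed by deciding them.
  to∘from : ∀ y → to (from y) ≡ y
  to∘from (ppset (pp U L upperN lowerE sameEnd meet) perimeter≡ _ _) = PPSet-≡
    (recompute (Listₚ.≡-dec _≟-Step_ _ U) (upper-word U L upperN lowerE sameEnd meet perimeter≡))
    (recompute (Listₚ.≡-dec _≟-Step_ _ L) (lower-word U L upperN lowerE sameEnd meet perimeter≡))

  from∘to : ∀ x → from (to x) ≡ x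
  from∘to (biinc w isPerm bi _ _) =
    BiIncPerm-≡ (recompute (Vecₚ.≡-dec Fin._≟_ _ w) (wordOf-polyominoOf w isPerm bi))

theorem3p10 : (n e k : ℕ) → 1 ≤ n → BiIncPerm n e k ⤖ PPSet n e k
theorem3p10 (suc m) e k _ = ↔⇒⤖ (mk↔ₛ′ to from to∘from from∘to)
  where open Bijection m e k
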